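{- Let $q$ be a prime power and let $f_1,\dots,f_t\colon\mathbb{F}_q^n\to\mathbb{F}_q$ be polynomials of degrees $d_1,\dots,d_t$ respectively. Let $k$ be the least integer satisfying \[ n\le k+\sum_{i=1}^{t}(d_i+1)\cdot\sum_{j=0}^{d_i-1}(d_i-j)\binom{k+j-1}{j}. \] Then for every $u_0\in\mathbb{F}_q^n$ there exists a linear subspace $U\subseteq\mathbb{F}_q^n$ of dimension $k$ such that for all $i\in[t]$, $f_i$ restricted to $u_0+U$ is constant. In particular, if $d_1,\dots,d_t\le d$ then $k=\Omega((n/t)^{1/(d-1)})$. Moreover, for $d\le\log(n/t)/10$, $k=\Omega(d\cdot(n/t)^{1/(d-1)})$.
   Context: Degree of a function on $\mathbb{F}_q^n$ means the total degree of its unique polynomial representation with individual degrees at most $q-1$. Logarithms are to base 2. Constants in $\Omega$ are universal. -}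

module Defs where

open import Level using (0ℓ)
open import Data.Nat using (ℕ; zero; suc; _+_; _*_; _∸_; _≤_; _<_; _⊔_)
open import Data.Nat.Combinatorics using (_C_)
open import Data.Fin using (Fin)
import Data.Fin as Fin
open import Data.List using (List; []; _∷_)
open import Data.List.Relation.Unary.All using (All)
open import Data.List.Relation.Unary.AllPairs using (AllPairs)
open import Data.Product using (_×_; _,_; proj₁; proj₂; Σ; ∃)
open import Relation.Binary.PropositionalEquality using (_≡_)
open import Relation.Nullary using (¬_)
open import Function.Bundles using (_↔_)
open import Algebra.Structures using (IsCommutativeRing)

-- A finite field of order q: a field whose carrier is in bijection
-- with Fin q.  (Such q is automatically a prime power, and every
-- finite field of order q is isomorphic to F_q.)

record FiniteField : Set₁ where
  field
    Carrier : Set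
    _+F_ _*F_ : Carrier → Carrier → Carrier
    -F_ : Carrier → Carrier
    0F 1F : Carrier
    isCommutativeRing : IsCommutativeRing _≡_ _+F_ _*F_ -F_ 0F 1F
    0≢1 : ¬ (0F ≡ 1F)
    inverse : (x : Carrier) → ¬ (x ≡ 0F) → ∃ λ y → (x *F y) ≡ 1F
    q : ℕ
    enum : Fin q ↔ Carrier

module FF (𝔽 : FiniteField) where
  open FiniteField 𝔽

  ΣF : {m : ℕ} → (Fin m → Carrier) → Carrier
  ΣF {zero} a = 0F
  ΣF {suc m} a = a Fin.zero +F ΣF (λ i → a (Fin.suc i))

  ΠF : {m : ℕ} → (Fin m → Carrier) → Carrier
  ΠF {zero} a = 1F
  ΠF {suc m} a = a Fin.zero *F ΠF (λ i → a (Fin.suc i))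

  _^F_ : Carrier → ℕ → Carrier
  x ^F zero = 1F
  x ^F suc e = x *F (x ^F e)

  Vecq : ℕ → Set
  Vecq n = Fin n → Carrier

  _+V_ : {n : ℕ} → Vecq n → Vecq n → Vecq n
  (u +V v) i = u i +F v i

  lincomb : {n k : ℕ} → (Fin k → Carrier) → (Fin k → Vecq n) → Vecq n
  lincomb a v i = ΣF (λ j → a j *F v j i)

  LinIndep : {n k : ℕ} → (Fin k → Vecq n) → Set
  LinIndep {n} {k} v = (a : Fin k → Carrier) →
    ((i : Fin n) → lincomb a v i ≡ 0F) → (j : Fin k) → a j ≡ 0F

  Exps : ℕ → Set
  Exps n = Fin n → ℕ

  sumℕF : {m : ℕ} → (Fin m → ℕ) → ℕ
  sumℕF {zero} e = 0
  sumℕF {suc m} e = e Fin.zero + sumℕF (λ i → e (Fin.suc i))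

  totalDeg : {n : ℕ} → Exps n → ℕ
  totalDeg = sumℕF

  monoEval : {n : ℕ} → Exps n → Vecq n → Carrier
  monoEval e x = ΠF (λ i → x i ^F e i)

  Poly : ℕ → Set
  Poly n = List (Carrier × Exps n)

  evalPoly : {n : ℕ} → Poly n → Vecq n → Carrier
  evalPoly [] x = 0F
  evalPoly ((c , e) ∷ p) x = (c *F monoEval e x) +F evalPoly p x

  polyDeg : {n : ℕ} → Poly n → ℕ
  polyDeg [] = 0
  polyDeg ((c , e) ∷ p) = totalDeg e ⊔ polyDeg p

  -- reduced form: nonzero coefficients, individual degrees ≤ q-1,
  -- pairwise distinct monomials (the unique representation of a function)
  Reduced : {n : ℕ} → Poly n → Set
  Reduced {n} p =
    All (λ m → ¬ (proj₁ m ≡ 0F) × ((i : Fin n) → proj₂ m i < q)) p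
    × AllPairs (λ m m' → ¬ ((i : Fin n) → proj₂ m i ≡ proj₂ m' i)) p

  -- f : F_q^n → F_q has degree d: its unique reduced polynomial
  -- representation has total degree d
  HasDegree : {n : ℕ} → (Vecq n → Carrier) → ℕ → Set
  HasDegree {n} f d = Σ (Poly n) λ p →
    Reduced p × ((x : Vecq n) → f x ≡ evalPoly p x) × polyDeg p ≡ d

  ConstOnAffine : {n t : ℕ} → (Fin t → Vecq n → Carrier) → Vecq n → ℕ → Set
  ConstOnAffine {n} {t} f u0 k = Σ (Fin k → Vecq n) λ v → LinIndep v ×
    ((i : Fin t) (a : Fin k → Carrier) → f i (u0 +V lincomb a v) ≡ f i u0)

sumBelow : ℕ → (ℕ → ℕ) → ℕ
sumBelow zero g = 0
sumBelow (suc m) g = sumBelow m g + g m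

sumFin : {t : ℕ} → (Fin t → ℕ) → ℕ
sumFin {zero} g = 0
sumFin {suc t} g = g Fin.zero + sumFin (λ i → g (Fin.suc i))

-- k + Σ_i (d_i+1) Σ_{j=0}^{d_i-1} (d_i - j) C(k+j-1, j)
-- (k+j-1 is (k+j) ∸ 1; the only case where this truncates is k=j=0,
--  where C(-1,0) = 1 = C(0,0) anyway.)
bound : {t : ℕ} → (Fin t → ℕ) → ℕ → ℕ
bound ds k = k + sumFin (λ i → suc (ds i) *
  sumBelow (ds i) (λ j → (ds i ∸ j) * (((k + j) ∸ 1) C j)))

IsLeastK : (n : ℕ) {t : ℕ} → (Fin t → ℕ) → ℕ → Set
IsLeastK n ds k = n ≤ bound ds k × ((k' : ℕ) → k' < k → bound ds k' < n)

-- Suppose v₁ … v_k are independent and every fᵢ is constant on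
-- u₀ + span(v₁ … v_k). Expanding fᵢ(u₀ + a₀v + Σⱼ aⱼvⱼ) as a polynomial in a₀ … a_k, the
-- coefficient of a^B is a polynomial in v, homogeneous of degree B₀. If v kills all
-- coefficients with B₀ > 0 and the coordinates of v at pivot positions of v₁ … v_k, then
-- fᵢ is constant on u₀ + span(v, v₁ … v_k) and v is independent of v₁ … v_k. Counted
-- with degree there are at most bound ds k such equations, all vanishing at 0, so while
-- bound ds k < n Chevalley–Warning provides a nonzero common solution v.
-- The asymptotic bounds estimate C(k+j-1, j) using C(N, e) e! ≤ N^e, e^e ≤ 8^e e!
-- (from (1 + 1/e)^e ≤ 8), and C(N, r) ≤ 2^N when k < d.

module Submission where

open import Defs
open import Data.Nat as ℕ using (ℕ; zero; suc; _+_; _*_; _∸_; _^_; _!; _≤_; _<_; _≤′_; ≤′-refl; ≤′-step; z≤n; s≤s; NonZero)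
import Data.Nat.Properties as ℕₚ
open import Data.Nat.Combinatorics using (_C_; nCn≡1; nCk≡nPk/k!; nCk+nC[k+1]≡[n+1]C[k+1])
import Data.Nat.Combinatorics.Base as ℕC
open import Data.Nat.DivMod using (_/_; m/n*n≤m)
open import Data.Nat.ListAction using (sum)
open import Data.Nat.ListAction.Properties using (sum-++)
open import Data.Nat.Tactic.RingSolver using (solve-∀)
open import Data.Bool using (true; false)
open import Data.Fin as Fin using (Fin)
import Data.Fin.Properties as Finₚ
open import Data.Fin.Permutation using (Permutation; permutation)
open import Data.Vec using (Vec; []; _∷_)
open import Data.Vec.Relation.Unary.All as VecAll using ([]; _∷_)
open import Data.Vec.Functional using () renaming (_∷_ to _◂_)
open import Data.List as List using (List; []; _∷_; _++_)
import Data.List.Properties as Listₚ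
open import Data.List.Relation.Unary.All as All using (All; []; _∷_)
import Data.List.Relation.Unary.All.Properties as Allₚ
open import Data.Product using (_×_; _,_; proj₁; proj₂; Σ; ∃)
open import Data.Sum using (_⊎_; inj₁; inj₂)
open import Data.Empty using (⊥-elim)
open import Relation.Binary.PropositionalEquality
open import Relation.Nullary using (¬_; Dec; yes; no; ¬?; _×-dec_)
open import Relation.Nullary.Decidable using (decidable-stable)
open import Function.Bundles using (Inverse)
open import Algebra.Bundles using (CommutativeRing)
open import Algebra.Properties.CommutativeSemigroup ℕₚ.+-commutativeSemigroup
  using () renaming (interchange to ℕ-+-interchange)
open import Algebra.Properties.CommutativeSemigroup ℕₚ.*-commutativeSemigroup
  using () renaming (x∙yz≈y∙xz to ℕ-*-left-comm)

sumBelow-cong : ∀ J {g h : ℕ → ℕ} → (∀ j → j < J → g j ≡ h j) → sumBelow J g ≡ sumBelow J h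
sumBelow-cong zero _ = refl
sumBelow-cong (suc J) g≗h = cong₂ _+_ (sumBelow-cong J (λ j j<J → g≗h j (ℕₚ.m<n⇒m<1+n j<J))) (g≗h J ℕₚ.≤-refl)

sumBelow-mono : ∀ J {g h : ℕ → ℕ} → (∀ j → j < J → g j ≤ h j) → sumBelow J g ≤ sumBelow J h
sumBelow-mono zero _ = z≤n
sumBelow-mono (suc J) g≤h = ℕₚ.+-mono-≤ (sumBelow-mono J (λ j j<J → g≤h j (ℕₚ.m<n⇒m<1+n j<J))) (g≤h J ℕₚ.≤-refl)

sumBelow-≤ : ∀ J (g : ℕ → ℕ) {B} → (∀ j → j < J → g j ≤ B) → sumBelow J g ≤ J * B
sumBelow-≤ zero g _ = z≤n
sumBelow-≤ (suc J) g {B} g≤B = ℕₚ.≤-trans (ℕₚ.+-mono-≤ (sumBelow-≤ J g (λ j j<J → g≤B j (ℕₚ.m<n⇒m<1+n j<J))) (g≤B J ℕₚ.≤-refl))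
                                          (ℕₚ.≤-reflexive (ℕₚ.+-comm (J * B) B))

sumBelow-*ˡ : ∀ J c (g : ℕ → ℕ) → sumBelow J (λ j → c * g j) ≡ c * sumBelow J g
sumBelow-*ˡ zero c g = sym (ℕₚ.*-zeroʳ c)
sumBelow-*ˡ (suc J) c g = trans (cong (_+ c * g J) (sumBelow-*ˡ J c g)) (sym (ℕₚ.*-distribˡ-+ c _ _))

sumFin-mono : ∀ {t} (g h : Fin t → ℕ) → (∀ i → g i ≤ h i) → sumFin g ≤ sumFin h
sumFin-mono {zero} g h _ = z≤n
sumFin-mono {suc t} g h g≤h = ℕₚ.+-mono-≤ (g≤h Fin.zero) (sumFin-mono (λ i → g (Fin.suc i)) (λ i → h (Fin.suc i)) (λ i → g≤h (Fin.suc i)))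

sumFin-≤ : ∀ {t} (g : Fin t → ℕ) {X} → (∀ i → g i ≤ X) → sumFin g ≤ t * X
sumFin-≤ {zero} g _ = z≤n
sumFin-≤ {suc t} g g≤X = ℕₚ.+-mono-≤ (g≤X Fin.zero) (sumFin-≤ (λ i → g (Fin.suc i)) (λ i → g≤X (Fin.suc i)))

hockey-stick : ∀ k j → sumBelow (suc j) (λ i → (k + i) C i) ≡ (suc k + j) C j
hockey-stick k zero = refl
hockey-stick k (suc j) = begin
  sumBelow (suc j) (λ i → (k + i) C i) + (k + suc j) C suc j ≡⟨ cong₂ _+_ (hockey-stick k j) (cong (_C suc j) (ℕₚ.+-suc k j)) ⟩
  (suc k + j) C j + (suc k + j) C suc j                     ≡⟨ nCk+nC[k+1]≡[n+1]C[k+1] (suc k + j) j ⟩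
  suc (suc k + j) C suc j                                  ≡⟨ cong (λ m → suc m C suc j) (sym (ℕₚ.+-suc k j)) ⟩
  (suc k + suc j) C suc j                                  ∎
  where open ≡-Reasoning

C-mono : ∀ k {i j} → i ≤ j → (k + i) C i ≤ (k + j) C j
C-mono k i≤j = go (ℕₚ.≤⇒≤′ i≤j)
  where
  step : ∀ j → (k + j) C j ≤ (k + suc j) C suc j
  step j = ℕₚ.≤-trans (ℕₚ.m≤m+n _ _) (ℕₚ.≤-reflexive
             (trans (nCk+nC[k+1]≡[n+1]C[k+1] (k + j) j) (cong (_C suc j) (sym (ℕₚ.+-suc k j)))))
  go : ∀ {i j} → i ≤′ j → (k + i) C i ≤ (k + j) C j
  go ≤′-refl = ℕₚ.≤-refl
  go (≤′-step i≤′j) = ℕₚ.≤-trans (go i≤′j) (step _)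

-- j ranges over the degree bound of the tail, so the leading exponent is D ∸ j.
blocks : ∀ {m} → (ℕ → List (Fin m → ℕ)) → ℕ → ℕ → List (Fin (suc m) → ℕ)
blocks monos D zero = []
blocks monos D (suc j) = blocks monos D j ++ List.map ((D ∸ j) ◂_) (monos j)

-- All exponent vectors of total degree at most D, each exactly once.
monomialsUpTo : ∀ m → ℕ → List (Fin m → ℕ)
monomialsUpTo zero D = (λ ()) ∷ []
monomialsUpTo (suc m) D = blocks (monomialsUpTo m) D (suc D)

infix 4 _≟ₑ_
_≟ₑ_ : ∀ {m} (A B : Fin m → ℕ) → Dec (∀ i → A i ≡ B i)
A ≟ₑ B = Finₚ.all? (λ i → A i ℕ.≟ B i)

leadingSum : ∀ {m} → List (Fin (suc m) → ℕ) → ℕ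
leadingSum Bs = sum (List.map (λ B → B Fin.zero) Bs)

length-blocks : ∀ {m} (monos : ℕ → List (Fin m → ℕ)) D J →
  List.length (blocks monos D J) ≡ sumBelow J (λ j → List.length (monos j))
length-blocks monos D zero = refl
length-blocks monos D (suc J) = trans (Listₚ.length-++ (blocks monos D J))
  (cong₂ _+_ (length-blocks monos D J) (Listₚ.length-map ((D ∸ J) ◂_) (monos J)))

leadingSum-blocks : ∀ {m} (monos : ℕ → List (Fin m → ℕ)) D J →
  leadingSum (blocks monos D J) ≡ sumBelow J (λ j → (D ∸ j) * List.length (monos j))
leadingSum-blocks monos D zero = refl
leadingSum-blocks monos D (suc J) = begin
  leadingSum (blocks monos D J ++ List.map ((D ∸ J) ◂_) (monos J))
    ≡⟨ cong sum (Listₚ.map-++ (λ B → B Fin.zero) (blocks monos D J) _) ⟩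
  sum (List.map (λ B → B Fin.zero) (blocks monos D J) ++ List.map (λ B → B Fin.zero) (List.map ((D ∸ J) ◂_) (monos J)))
    ≡⟨ sum-++ (List.map (λ B → B Fin.zero) (blocks monos D J)) _ ⟩
  leadingSum (blocks monos D J) + sum (List.map (λ B → B Fin.zero) (List.map ((D ∸ J) ◂_) (monos J)))
    ≡⟨ cong₂ _+_ (leadingSum-blocks monos D J) (sum-constant (monos J)) ⟩
  sumBelow J (λ j → (D ∸ j) * List.length (monos j)) + (D ∸ J) * List.length (monos J) ∎
  where
  open ≡-Reasoning
  sum-constant : ∀ Bs → sum (List.map (λ B → B Fin.zero) (List.map ((D ∸ J) ◂_) Bs)) ≡ (D ∸ J) * List.length Bs
  sum-constant [] = sym (ℕₚ.*-zeroʳ (D ∸ J))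
  sum-constant (B ∷ Bs) = trans (cong ((D ∸ J) +_) (sum-constant Bs)) (sym (ℕₚ.*-suc (D ∸ J) _))

length-monomialsUpTo : ∀ k j → List.length (monomialsUpTo k j) ≡ (k + j) C j
length-monomialsUpTo zero j = sym (nCn≡1 j)
length-monomialsUpTo (suc k) j = trans (length-blocks (monomialsUpTo k) j (suc j))
  (trans (sumBelow-cong (suc j) (λ i _ → length-monomialsUpTo k i)) (hockey-stick k j))

length-monomialsUpTo-≤ : ∀ k j → List.length (monomialsUpTo (suc k) j) ≤ suc j * ((k + j) C j)
length-monomialsUpTo-≤ k j = begin
  List.length (monomialsUpTo (suc k) j)  ≡⟨ length-monomialsUpTo (suc k) j ⟩
  (suc k + j) C j                        ≡⟨ sym (hockey-stick k j) ⟩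
  sumBelow (suc j) (λ i → (k + i) C i)   ≤⟨ sumBelow-≤ (suc j) _ (λ i i<1+j → C-mono k (ℕₚ.≤-pred i<1+j)) ⟩
  suc j * ((k + j) C j)                  ∎
  where open ℕₚ.≤-Reasoning

-- For k = 0 only the j = 0 term of the paper's sum survives: (j ∸ 1) C j = 0 for j > 0.
weightedCount-≤ : ∀ k D → sumBelow D (λ j → (D ∸ j) * List.length (monomialsUpTo k j)) ≤
                         suc D * sumBelow D (λ j → (D ∸ j) * (((k + j) ∸ 1) C j))
weightedCount-≤ zero zero = z≤n
weightedCount-≤ zero (suc D) = begin
  sumBelow (suc D) (λ j → (suc D ∸ j) * 1)            ≤⟨ sumBelow-≤ (suc D) _ (λ j _ → ℕₚ.≤-trans (ℕₚ.≤-reflexive (ℕₚ.*-identityʳ _)) (ℕₚ.m∸n≤m (suc D) j)) ⟩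
  suc D * suc D                                      ≤⟨ ℕₚ.*-monoʳ-≤ (suc D) (ℕₚ.≤-trans (ℕₚ.≤-reflexive (sym (ℕₚ.*-identityʳ (suc D)))) (first-term≤ D _)) ⟩
  suc D * sumBelow (suc D) (λ j → (suc D ∸ j) * ((j ∸ 1) C j)) ≤⟨ ℕₚ.*-monoˡ-≤ _ (ℕₚ.n≤1+n (suc D)) ⟩
  suc (suc D) * sumBelow (suc D) (λ j → (suc D ∸ j) * ((j ∸ 1) C j)) ∎
  where
  open ℕₚ.≤-Reasoning
  first-term≤ : ∀ J (g : ℕ → ℕ) → g 0 ≤ sumBelow (suc J) g
  first-term≤ zero g = ℕₚ.≤-refl
  first-term≤ (suc J) g = ℕₚ.≤-trans (first-term≤ J g) (ℕₚ.m≤m+n _ _)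
weightedCount-≤ (suc k) D = begin
  sumBelow D (λ j → (D ∸ j) * List.length (monomialsUpTo (suc k) j))
    ≤⟨ sumBelow-mono D (λ j j<D → ℕₚ.*-monoʳ-≤ (D ∸ j)
         (ℕₚ.≤-trans (length-monomialsUpTo-≤ k j) (ℕₚ.*-monoˡ-≤ _ (ℕₚ.≤-trans j<D (ℕₚ.n≤1+n D))))) ⟩
  sumBelow D (λ j → (D ∸ j) * (suc D * ((k + j) C j)))
    ≡⟨ sumBelow-cong D (λ j _ → ℕ-*-left-comm (D ∸ j) (suc D) _) ⟩
  sumBelow D (λ j → suc D * ((D ∸ j) * ((k + j) C j)))
    ≡⟨ sumBelow-*ˡ D (suc D) _ ⟩
  suc D * sumBelow D (λ j → (D ∸ j) * ((k + j) C j)) ∎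
  where open ℕₚ.≤-Reasoning

-- The paper's estimate (D+1) Σ_{j<D} (D-j) C(k+j-1, j) for the degrees of the equations
-- that keep a polynomial of degree D constant along a new direction.
leadingSum-monomialsUpTo : ∀ k D →
  leadingSum (monomialsUpTo (suc k) D) ≤ suc D * sumBelow D (λ j → (D ∸ j) * (((k + j) ∸ 1) C j))
leadingSum-monomialsUpTo k D = begin
  leadingSum (monomialsUpTo (suc k) D)                            ≡⟨ leadingSum-blocks (monomialsUpTo k) D (suc D) ⟩
  sumBelow D weighted + (D ∸ D) * List.length (monomialsUpTo k D) ≡⟨ cong (λ z → sumBelow D weighted + z * List.length (monomialsUpTo k D)) (ℕₚ.n∸n≡0 D) ⟩
  sumBelow D weighted + 0                                         ≡⟨ ℕₚ.+-identityʳ _ ⟩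
  sumBelow D weighted                                             ≤⟨ weightedCount-≤ k D ⟩
  suc D * sumBelow D (λ j → (D ∸ j) * (((k + j) ∸ 1) C j))        ∎
  where
  open ℕₚ.≤-Reasoning
  weighted : ℕ → ℕ
  weighted j = (D ∸ j) * List.length (monomialsUpTo k j)

module _ (𝔽 : FiniteField) where
  open FiniteField 𝔽
  open FF 𝔽

  commutativeRing : CommutativeRing _ _
  commutativeRing = record { isCommutativeRing = isCommutativeRing }

  open CommutativeRing commutativeRing
    using ( +-assoc; +-comm; *-assoc; *-comm; +-identityˡ; +-identityʳ; *-identityˡ; *-identityʳ
          ; zeroˡ; zeroʳ; distribˡ; distribʳ; -‿inverseˡ; -‿inverseʳ; +-group
          ; +-commutativeSemigroup; *-commutativeSemigroup; +-commutativeMonoid; ring)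
  open import Algebra.Properties.Group +-group
    using (identityʳ-unique; x∙y⁻¹≈ε⇒x≈y)
  open import Algebra.Properties.Ring ring using (-1*x≈-x; -‿distribˡ-*)
  open import Algebra.Properties.CommutativeSemigroup +-commutativeSemigroup
    using () renaming (interchange to +-interchange)
  open import Algebra.Solver.Ring.NaturalCoefficients.Default (CommutativeRing.commutativeSemiring commutativeRing)
    using (solve; _:=_; _:+_; _:*_)
  open import Algebra.Properties.CommutativeSemigroup *-commutativeSemigroup
    using () renaming (interchange to *-interchange; x∙yz≈y∙xz to *-left-comm)

  toF : Fin q → Carrier
  toF = Inverse.to enum

  fromF : Carrier → Fin q
  fromF = Inverse.from enum

  toF-fromF : ∀ x → toF (fromF x) ≡ x
  toF-fromF = Inverse.strictlyInverseˡ enum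

  fromF-toF : ∀ i → fromF (toF i) ≡ i
  fromF-toF = Inverse.strictlyInverseʳ enum

  toF-injective : ∀ {i j} → toF i ≡ toF j → i ≡ j
  toF-injective {i} {j} e = trans (sym (fromF-toF i)) (trans (cong fromF e) (fromF-toF j))

  infix 4 _≟_
  _≟_ : (x y : Carrier) → Dec (x ≡ y)
  x ≟ y with fromF x Finₚ.≟ fromF y
  ... | yes p = yes (trans (sym (toF-fromF x)) (trans (cong toF p) (toF-fromF y)))
  ... | no ¬p = no (λ e → ¬p (cong fromF e))

  1≢0 : ¬ 1F ≡ 0F
  1≢0 e = 0≢1 (sym e)

  2≤q : 2 ≤ q
  2≤q = distinct⇒2≤ (fromF 0F) (fromF 1F) (λ e → 0≢1 (trans (sym (toF-fromF 0F)) (trans (cong toF e) (toF-fromF 1F))))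
    where
    distinct⇒2≤ : ∀ {m} (i j : Fin m) → ¬ i ≡ j → 2 ≤ m
    distinct⇒2≤ {1} Fin.zero Fin.zero i≢j = ⊥-elim (i≢j refl)
    distinct⇒2≤ {suc (suc m)} _ _ _ = s≤s (s≤s z≤n)

  x-y≡0⇒x≡y : ∀ {x y} → x +F (-F y) ≡ 0F → x ≡ y
  x-y≡0⇒x≡y = x∙y⁻¹≈ε⇒x≈y _ _

  _⁻¹⟨_⟩ : (x : Carrier) → ¬ x ≡ 0F → Carrier
  x ⁻¹⟨ x≢0 ⟩ = proj₁ (inverse x x≢0)

  x*x⁻¹≡1 : ∀ x (x≢0 : ¬ x ≡ 0F) → x *F (x ⁻¹⟨ x≢0 ⟩) ≡ 1F
  x*x⁻¹≡1 x x≢0 = proj₂ (inverse x x≢0)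

  x*y≡0⇒y≡0 : ∀ {x y} → ¬ x ≡ 0F → x *F y ≡ 0F → y ≡ 0F
  x*y≡0⇒y≡0 {x} {y} x≢0 xy≡0 = begin
    y                  ≡⟨ sym (*-identityˡ y) ⟩
    1F *F y            ≡⟨ cong (_*F y) (sym (trans (*-comm _ _) (x*x⁻¹≡1 x x≢0))) ⟩
    (x⁻¹ *F x) *F y    ≡⟨ *-assoc _ _ _ ⟩
    x⁻¹ *F (x *F y)    ≡⟨ cong (x⁻¹ *F_) xy≡0 ⟩
    x⁻¹ *F 0F          ≡⟨ zeroʳ _ ⟩
    0F                 ∎
    where open ≡-Reasoning
          x⁻¹ = x ⁻¹⟨ x≢0 ⟩

  x≡0⇒x*y≡0 : ∀ {x} y → x ≡ 0F → x *F y ≡ 0F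
  x≡0⇒x*y≡0 y refl = zeroˡ y

  y≡0⇒x*y≡0 : ∀ x {y} → y ≡ 0F → x *F y ≡ 0F
  y≡0⇒x*y≡0 x refl = zeroʳ x

  ^F-+ : ∀ x a b → x ^F (a + b) ≡ (x ^F a) *F (x ^F b)
  ^F-+ x zero b = sym (*-identityˡ _)
  ^F-+ x (suc a) b = trans (cong (x *F_) (^F-+ x a b)) (sym (*-assoc _ _ _))

  ^F-distrib-* : ∀ x y e → (x *F y) ^F e ≡ (x ^F e) *F (y ^F e)
  ^F-distrib-* x y zero = sym (*-identityˡ _)
  ^F-distrib-* x y (suc e) = trans (cong ((x *F y) *F_) (^F-distrib-* x y e)) (*-interchange x y _ _)

  ΣF-cong : ∀ {m} {a b : Fin m → Carrier} → (∀ i → a i ≡ b i) → ΣF a ≡ ΣF b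
  ΣF-cong {zero} h = refl
  ΣF-cong {suc m} h = cong₂ _+F_ (h Fin.zero) (ΣF-cong (λ i → h (Fin.suc i)))

  ΣF-+ : ∀ {m} (a b : Fin m → Carrier) → ΣF (λ i → a i +F b i) ≡ ΣF a +F ΣF b
  ΣF-+ {zero} a b = sym (+-identityˡ _)
  ΣF-+ {suc m} a b = trans (cong ((a Fin.zero +F b Fin.zero) +F_) (ΣF-+ (λ i → a (Fin.suc i)) (λ i → b (Fin.suc i)))) (+-interchange _ _ _ _)

  ΣF-*ˡ : ∀ {m} c (a : Fin m → Carrier) → ΣF (λ i → c *F a i) ≡ c *F ΣF a
  ΣF-*ˡ {zero} c a = sym (zeroʳ c)
  ΣF-*ˡ {suc m} c a = trans (cong ((c *F a Fin.zero) +F_) (ΣF-*ˡ c (λ i → a (Fin.suc i)))) (sym (distribˡ _ _ _))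

  ΣF-*ʳ : ∀ {m} c (a : Fin m → Carrier) → ΣF (λ i → a i *F c) ≡ ΣF a *F c
  ΣF-*ʳ c a = trans (ΣF-cong (λ i → *-comm (a i) c)) (trans (ΣF-*ˡ c a) (*-comm c _))

  ΣF-zero : ∀ {m} (a : Fin m → Carrier) → (∀ i → a i ≡ 0F) → ΣF a ≡ 0F
  ΣF-zero {zero} a h = refl
  ΣF-zero {suc m} a h = trans (cong₂ _+F_ (h Fin.zero) (ΣF-zero _ (λ i → h (Fin.suc i)))) (+-identityˡ 0F)

  ΣF-single : ∀ {m} (a : Fin m → Carrier) i₀ → (∀ i → ¬ i ≡ i₀ → a i ≡ 0F) → ΣF a ≡ a i₀
  ΣF-single {suc m} a Fin.zero h =
    trans (cong (a Fin.zero +F_) (ΣF-zero _ (λ i → h (Fin.suc i) (λ ())))) (+-identityʳ _)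
  ΣF-single {suc m} a (Fin.suc i₀) h =
    trans (cong₂ _+F_ (h Fin.zero (λ ())) (ΣF-single (λ i → a (Fin.suc i)) i₀ (λ i i≢i₀ → h (Fin.suc i) (λ e → i≢i₀ (Finₚ.suc-injective e)))))
          (+-identityˡ _)

  ΠF-cong : ∀ {m} {a b : Fin m → Carrier} → (∀ i → a i ≡ b i) → ΠF a ≡ ΠF b
  ΠF-cong {zero} h = refl
  ΠF-cong {suc m} h = cong₂ _*F_ (h Fin.zero) (ΠF-cong (λ i → h (Fin.suc i)))

  ΠF-one : ∀ {m} (a : Fin m → Carrier) → (∀ i → a i ≡ 1F) → ΠF a ≡ 1F
  ΠF-one {zero} a h = refl
  ΠF-one {suc m} a h = trans (cong₂ _*F_ (h Fin.zero) (ΠF-one _ (λ i → h (Fin.suc i)))) (*-identityˡ 1F)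

  ΠF-zero : ∀ {m} (a : Fin m → Carrier) i₀ → a i₀ ≡ 0F → ΠF a ≡ 0F
  ΠF-zero {suc m} a Fin.zero e = trans (cong (_*F ΠF (λ i → a (Fin.suc i))) e) (zeroˡ _)
  ΠF-zero {suc m} a (Fin.suc i₀) e = trans (cong (a Fin.zero *F_) (ΠF-zero (λ i → a (Fin.suc i)) i₀ e)) (zeroʳ _)

  ΠF-* : ∀ {m} (a b : Fin m → Carrier) → ΠF (λ i → a i *F b i) ≡ ΠF a *F ΠF b
  ΠF-* {zero} a b = sym (*-identityˡ _)
  ΠF-* {suc m} a b = trans (cong ((a Fin.zero *F b Fin.zero) *F_) (ΠF-* (λ i → a (Fin.suc i)) (λ i → b (Fin.suc i)))) (*-interchange _ _ _ _)

  ΣC : (Carrier → Carrier) → Carrier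
  ΣC h = ΣF (λ i → h (toF i))

  ΣC-cong : ∀ {h h′} → (∀ x → h x ≡ h′ x) → ΣC h ≡ ΣC h′
  ΣC-cong e = ΣF-cong (λ i → e (toF i))

  open import Algebra.Properties.CommutativeMonoid.Sum +-commutativeMonoid using (sum-permute) renaming (sum to ∑)

  ∑≡ΣF : ∀ {m} (a : Fin m → Carrier) → ∑ a ≡ ΣF a
  ∑≡ΣF {zero} a = refl
  ∑≡ΣF {suc m} a = cong (a Fin.zero +F_) (∑≡ΣF (λ i → a (Fin.suc i)))

  ΣC-reindex : (σ τ : Carrier → Carrier) → (∀ x → σ (τ x) ≡ x) → (∀ x → τ (σ x) ≡ x) →
               (h : Carrier → Carrier) → ΣC (λ x → h (σ x)) ≡ ΣC h
  ΣC-reindex σ τ στ τσ h = begin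
    ΣC (λ x → h (σ x))                ≡⟨ ΣC-cong (λ x → cong h (sym (toF-fromF (σ x)))) ⟩
    ΣF (λ i → h (toF (π⃗ i)))          ≡⟨ sym (∑≡ΣF (λ i → h (toF (π⃗ i)))) ⟩
    ∑ (λ i → h (toF (π⃗ i)))           ≡⟨ sym (sum-permute (λ i → h (toF i)) π) ⟩
    ∑ (λ i → h (toF i))               ≡⟨ ∑≡ΣF (λ i → h (toF i)) ⟩
    ΣC h                              ∎
    where
    open ≡-Reasoning
    π⃗ π⃖ : Fin q → Fin q
    π⃗ i = fromF (σ (toF i))
    π⃖ i = fromF (τ (toF i))
    π : Permutation q q
    π = permutation π⃗ π⃖
      (λ i → trans (cong (λ x → fromF (σ x)) (toF-fromF _)) (trans (cong fromF (στ _)) (fromF-toF i)))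
      (λ i → trans (cong (λ x → fromF (τ x)) (toF-fromF _)) (trans (cong fromF (τσ _)) (fromF-toF i)))

  -- Power sums

  horner : ∀ {m} → Vec Carrier m → Carrier → Carrier
  horner [] x = 0F
  horner (c ∷ cs) x = c +F (x *F horner cs x)

  remainder : ∀ {m} → Carrier → Vec Carrier (suc m) → Carrier
  remainder r (c ∷ []) = c
  remainder r (c ∷ c′ ∷ cs) = c +F (r *F remainder r (c′ ∷ cs))

  quotient : ∀ {m} → Carrier → Vec Carrier (suc m) → Vec Carrier m
  quotient r (c ∷ []) = []
  quotient r (c ∷ c′ ∷ cs) = remainder r (c′ ∷ cs) ∷ quotient r (c′ ∷ cs)

  horner-division : ∀ {m} r (cs : Vec Carrier (suc m)) x →
    horner cs x ≡ remainder r cs +F ((x +F (-F r)) *F horner (quotient r cs) x)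
  horner-division r (c ∷ []) x = trans (cong (c +F_) (zeroʳ x)) (sym (cong (c +F_) (zeroʳ _)))
  horner-division r (c ∷ c′ ∷ cs) x = begin
    c +F (x *F horner (c′ ∷ cs) x)            ≡⟨ cong (λ z → c +F (x *F z)) (horner-division r (c′ ∷ cs) x) ⟩
    c +F (x *F (ρ +F (s *F h)))               ≡⟨ cong (λ z → c +F (z *F (ρ +F (s *F h)))) (sym x≡s+r) ⟩
    c +F ((s +F r) *F (ρ +F (s *F h)))        ≡⟨ solve 5 (λ c s r ρ h → (c :+ ((s :+ r) :* (ρ :+ (s :* h))))
                                                         := ((c :+ (r :* ρ)) :+ (s :* (ρ :+ ((s :+ r) :* h))))) refl c s r ρ h ⟩
    (c +F (r *F ρ)) +F (s *F (ρ +F ((s +F r) *F h))) ≡⟨ cong (λ z → (c +F (r *F ρ)) +F (s *F (ρ +F (z *F h)))) x≡s+r ⟩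
    (c +F (r *F ρ)) +F (s *F (ρ +F (x *F h))) ∎
    where
    open ≡-Reasoning
    ρ = remainder r (c′ ∷ cs)
    s = x +F (-F r)
    h = horner (quotient r (c′ ∷ cs)) x
    x≡s+r : s +F r ≡ x
    x≡s+r = trans (+-assoc _ _ _) (trans (cong (x +F_) (-‿inverseˡ r)) (+-identityʳ x))

  division-by-root : ∀ {m} r (cs : Vec Carrier (suc m)) → remainder r cs ≡ 0F →
    VecAll.All (_≡ 0F) (quotient r cs) → VecAll.All (_≡ 0F) cs
  division-by-root r (c ∷ []) c≡0 [] = c≡0 ∷ []
  division-by-root r (c ∷ c′ ∷ cs) rem≡0 (ρ≡0 ∷ quot≡0) =
    trans (sym (trans (cong (λ z → c +F (r *F z)) ρ≡0) (trans (cong (c +F_) (zeroʳ r)) (+-identityʳ c)))) rem≡0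
    ∷ division-by-root r (c′ ∷ cs) ρ≡0 quot≡0

  vanishing⇒zero : ∀ {m} (cs : Vec Carrier m) (r : Fin m → Carrier) → (∀ i j → r i ≡ r j → i ≡ j) →
    (∀ i → horner cs (r i) ≡ 0F) → VecAll.All (_≡ 0F) cs
  vanishing⇒zero [] r r-inj roots = []
  vanishing⇒zero {suc m} cs r r-inj roots =
    division-by-root r₀ cs rem≡0
      (vanishing⇒zero (quotient r₀ cs) (λ i → r (Fin.suc i)) (λ i j e → Finₚ.suc-injective (r-inj _ _ e)) quot-roots)
    where
    r₀ = r Fin.zero
    rem≡0 : remainder r₀ cs ≡ 0F
    rem≡0 = begin
      remainder r₀ cs                                                  ≡⟨ sym (+-identityʳ _) ⟩
      remainder r₀ cs +F 0F                                            ≡⟨ cong (remainder r₀ cs +F_) (sym (zeroˡ _)) ⟩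
      remainder r₀ cs +F (0F *F horner (quotient r₀ cs) r₀)            ≡⟨ cong (λ z → remainder r₀ cs +F (z *F horner (quotient r₀ cs) r₀)) (sym (-‿inverseʳ r₀)) ⟩
      remainder r₀ cs +F ((r₀ +F (-F r₀)) *F horner (quotient r₀ cs) r₀) ≡⟨ sym (horner-division r₀ cs r₀) ⟩
      horner cs r₀                                                     ≡⟨ roots Fin.zero ⟩
      0F                                                               ∎
      where open ≡-Reasoning
    quot-roots : ∀ i → horner (quotient r₀ cs) (r (Fin.suc i)) ≡ 0F
    quot-roots i = x*y≡0⇒y≡0 rᵢ-r₀≢0 (begin
      (rᵢ +F (-F r₀)) *F horner (quotient r₀ cs) rᵢ                 ≡⟨ sym (+-identityˡ _) ⟩
      0F +F ((rᵢ +F (-F r₀)) *F horner (quotient r₀ cs) rᵢ)         ≡⟨ cong (_+F ((rᵢ +F (-F r₀)) *F horner (quotient r₀ cs) rᵢ)) (sym rem≡0) ⟩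
      remainder r₀ cs +F ((rᵢ +F (-F r₀)) *F horner (quotient r₀ cs) rᵢ) ≡⟨ sym (horner-division r₀ cs rᵢ) ⟩
      horner cs rᵢ                                                  ≡⟨ roots (Fin.suc i) ⟩
      0F                                                            ∎)
      where
      open ≡-Reasoning
      rᵢ = r (Fin.suc i)
      rᵢ-r₀≢0 : ¬ rᵢ +F (-F r₀) ≡ 0F
      rᵢ-r₀≢0 e with r-inj (Fin.suc i) Fin.zero (x-y≡0⇒x≡y e)
      ... | ()

  monomial : ∀ k → Vec Carrier (suc k)
  monomial zero = 1F ∷ []
  monomial (suc k) = 0F ∷ monomial k

  horner-monomial : ∀ k x → horner (monomial k) x ≡ x ^F k
  horner-monomial zero x = trans (cong (1F +F_) (zeroʳ x)) (+-identityʳ 1F)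
  horner-monomial (suc k) x = trans (+-identityˡ _) (cong (x *F_) (horner-monomial k x))

  -- Otherwise x^(e+1) - x, with e + 2 coefficients, would vanish at e + 2 ≤ q points.
  ∃-nonzero-x^e≢1 : ∀ e → 1 ≤ e → 2 + e ≤ q → ∃ λ c → ¬ c ≡ 0F × ¬ c ^F e ≡ 1F
  ∃-nonzero-x^e≢1 (suc e) _ 2+e≤q with Finₚ.any? (λ i → ¬? (toF i ≟ 0F) ×-dec ¬? (toF i ^F suc e ≟ 1F))
  ... | yes (i , p) = toF i , p
  ... | no ¬∃ = ⊥-elim (1≢0 1≡0)
    where
    x^e≡1 : ∀ x → ¬ x ≡ 0F → x ^F suc e ≡ 1F
    x^e≡1 x x≢0 = decidable-stable (x ^F suc e ≟ 1F)
      (λ x^e≢1 → ¬∃ (fromF x , subst (λ y → ¬ y ≡ 0F × ¬ y ^F suc e ≡ 1F) (sym (toF-fromF x)) (x≢0 , x^e≢1)))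
    cs : Vec Carrier (2 + suc e)
    cs = 0F ∷ (-F 1F) ∷ monomial e
    root : ∀ x → horner cs x ≡ 0F
    root x with x ≟ 0F
    ... | yes x≡0 = trans (+-identityˡ _) (trans (cong (_*F ((-F 1F) +F (x *F horner (monomial e) x))) x≡0) (zeroˡ _))
    ... | no x≢0 = trans (+-identityˡ _) (trans (cong (x *F_) inner) (zeroʳ x))
      where
      inner : (-F 1F) +F (x *F horner (monomial e) x) ≡ 0F
      inner = trans (cong (λ z → (-F 1F) +F (x *F z)) (horner-monomial e x))
                (trans (cong ((-F 1F) +F_) (x^e≡1 x x≢0)) (-‿inverseˡ 1F))
    points : Fin (2 + suc e) → Carrier
    points i = toF (Fin.inject≤ i 2+e≤q)
    -1≡0 : -F 1F ≡ 0F
    -1≡0 = VecAll.head (VecAll.tail (vanishing⇒zero cs points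
             (λ i j e → Finₚ.inject≤-injective 2+e≤q 2+e≤q i j (toF-injective e)) (λ i → root (points i))))
    1≡0 : 1F ≡ 0F
    1≡0 = trans (sym (trans (cong (1F +F_) -1≡0) (+-identityʳ 1F))) (-‿inverseʳ 1F)

  -- x ↦ x + 1 permutes the field.
  ΣC-one : ΣC (λ _ → 1F) ≡ 0F
  ΣC-one = identityʳ-unique (ΣC (λ x → x)) (ΣC (λ _ → 1F)) (begin
    ΣC (λ x → x) +F ΣC (λ _ → 1F) ≡⟨ sym (ΣF-+ toF (λ _ → 1F)) ⟩
    ΣC (λ x → x +F 1F)            ≡⟨ ΣC-reindex (_+F 1F) (_+F (-F 1F)) (cancel (-‿inverseʳ 1F)) (cancel (-‿inverseˡ 1F)) (λ x → x) ⟩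
    ΣC (λ x → x)                  ∎)
    where
    open ≡-Reasoning
    cancel : ∀ {a b} → b +F a ≡ 0F → ∀ x → (x +F a) +F b ≡ x
    cancel {a} {b} b+a≡0 x = trans (+-assoc _ _ _) (trans (cong (x +F_) (trans (+-comm a b) b+a≡0)) (+-identityʳ x))

  -- Multiplication by c ≠ 0 permutes the field, so Σ x^e = c^e Σ x^e, and c^e ≠ 1 for some c.
  ΣC-^ : ∀ e → e < q ∸ 1 → ΣC (λ x → x ^F e) ≡ 0F
  ΣC-^ zero _ = ΣC-one
  ΣC-^ (suc e) e<q-1 = x*y≡0⇒y≡0 c^e-1≢0 (begin
    ((c ^F suc e) +F (-F 1F)) *F S       ≡⟨ distribʳ S (c ^F suc e) (-F 1F) ⟩
    ((c ^F suc e) *F S) +F ((-F 1F) *F S) ≡⟨ cong₂ _+F_ scaled (-1*x≈-x S) ⟩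
    S +F (-F S)                          ≡⟨ -‿inverseʳ S ⟩
    0F                                   ∎)
    where
    open ≡-Reasoning
    2+e≤q : 2 + suc e ≤ q
    2+e≤q = ℕₚ.≤-trans (s≤s e<q-1) (ℕₚ.≤-reflexive (ℕₚ.m+[n∸m]≡n (ℕₚ.≤-trans (s≤s z≤n) 2≤q)))
    witness = ∃-nonzero-x^e≢1 (suc e) (s≤s z≤n) 2+e≤q
    c = proj₁ witness
    c≢0 = proj₁ (proj₂ witness)
    S = ΣC (λ x → x ^F suc e)
    c^e-1≢0 : ¬ (c ^F suc e) +F (-F 1F) ≡ 0F
    c^e-1≢0 e = proj₂ (proj₂ witness) (x-y≡0⇒x≡y e)
    c⁻¹ = c ⁻¹⟨ c≢0 ⟩
    scaled : (c ^F suc e) *F S ≡ S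
    scaled = begin
      (c ^F suc e) *F S                 ≡⟨ sym (ΣF-*ˡ (c ^F suc e) (λ i → toF i ^F suc e)) ⟩
      ΣC (λ x → (c ^F suc e) *F (x ^F suc e)) ≡⟨ ΣC-cong (λ x → sym (^F-distrib-* c x (suc e))) ⟩
      ΣC (λ x → (c *F x) ^F suc e)      ≡⟨ ΣC-reindex (c *F_) (c⁻¹ *F_) (rescale (x*x⁻¹≡1 c c≢0)) (rescale (trans (*-comm _ _) (x*x⁻¹≡1 c c≢0))) (_^F suc e) ⟩
      S                                 ∎
      where
      rescale : ∀ {a b} → a *F b ≡ 1F → ∀ x → a *F (b *F x) ≡ x
      rescale ab≡1 x = trans (sym (*-assoc _ _ _)) (trans (cong (_*F x) ab≡1) (*-identityˡ x))

  0ₑ : ∀ {n} → Exps n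
  0ₑ _ = 0

  _+ₑ_ : ∀ {n} → Exps n → Exps n → Exps n
  (e +ₑ e′) i = e i + e′ i

  totalDeg-0ₑ : ∀ {n} → totalDeg (0ₑ {n}) ≡ 0
  totalDeg-0ₑ {zero} = refl
  totalDeg-0ₑ {suc n} = totalDeg-0ₑ {n}

  totalDeg-+ₑ : ∀ {n} (e e′ : Exps n) → totalDeg (e +ₑ e′) ≡ totalDeg e + totalDeg e′
  totalDeg-+ₑ {zero} e e′ = refl
  totalDeg-+ₑ {suc n} e e′ = trans (cong (e Fin.zero + e′ Fin.zero +_) (totalDeg-+ₑ (λ i → e (Fin.suc i)) (λ i → e′ (Fin.suc i))))
                                  (ℕ-+-interchange (e Fin.zero) (e′ Fin.zero) _ _)

  1P : ∀ {n} → Poly n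
  1P = (1F , 0ₑ) ∷ []

  scaleP : ∀ {n} → Carrier → Poly n → Poly n
  scaleP c [] = []
  scaleP c ((c′ , e) ∷ Q) = (c *F c′ , e) ∷ scaleP c Q

  mulMonomial : ∀ {n} → Carrier → Exps n → Poly n → Poly n
  mulMonomial c e [] = []
  mulMonomial c e ((c′ , e′) ∷ Q) = (c *F c′ , e +ₑ e′) ∷ mulMonomial c e Q

  infixl 7 _*P_
  _*P_ : ∀ {n} → Poly n → Poly n → Poly n
  [] *P Q = []
  ((c , e) ∷ P) *P Q = mulMonomial c e Q ++ P *P Q

  ΠP : ∀ {n m} → (Fin m → Poly n) → Poly n
  ΠP {m = zero} F = 1P
  ΠP {m = suc m} F = F Fin.zero *P ΠP (λ i → F (Fin.suc i))

  monoEval-cong : ∀ {n} (e : Exps n) {x y : Vecq n} → (∀ i → x i ≡ y i) → monoEval e x ≡ monoEval e y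
  monoEval-cong e x≗y = ΠF-cong (λ i → cong (_^F e i) (x≗y i))

  monoEval-0ₑ : ∀ {n} (x : Vecq n) → monoEval 0ₑ x ≡ 1F
  monoEval-0ₑ x = ΠF-one (λ i → x i ^F 0) (λ i → refl)

  monoEval-+ₑ : ∀ {n} (e e′ : Exps n) x → monoEval (e +ₑ e′) x ≡ monoEval e x *F monoEval e′ x
  monoEval-+ₑ e e′ x = trans (ΠF-cong (λ i → ^F-+ (x i) (e i) (e′ i))) (ΠF-* (λ i → x i ^F e i) (λ i → x i ^F e′ i))

  evalPoly-cong : ∀ {n} (P : Poly n) {x y : Vecq n} → (∀ i → x i ≡ y i) → evalPoly P x ≡ evalPoly P y
  evalPoly-cong [] x≗y = refl
  evalPoly-cong ((c , e) ∷ P) x≗y = cong₂ _+F_ (cong (c *F_) (monoEval-cong e x≗y)) (evalPoly-cong P x≗y)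

  evalPoly-++ : ∀ {n} (P Q : Poly n) x → evalPoly (P ++ Q) x ≡ evalPoly P x +F evalPoly Q x
  evalPoly-++ [] Q x = sym (+-identityˡ _)
  evalPoly-++ ((c , e) ∷ P) Q x = trans (cong ((c *F monoEval e x) +F_) (evalPoly-++ P Q x)) (sym (+-assoc _ _ _))

  evalPoly-1P : ∀ {n} (x : Vecq n) → evalPoly 1P x ≡ 1F
  evalPoly-1P x = trans (+-identityʳ _) (trans (*-identityˡ _) (monoEval-0ₑ x))

  evalPoly-scaleP : ∀ {n} c (Q : Poly n) x → evalPoly (scaleP c Q) x ≡ c *F evalPoly Q x
  evalPoly-scaleP c [] x = sym (zeroʳ c)
  evalPoly-scaleP c ((c′ , e) ∷ Q) x = trans (cong₂ _+F_ (*-assoc _ _ _) (evalPoly-scaleP c Q x)) (sym (distribˡ _ _ _))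

  evalPoly-mulMonomial : ∀ {n} c e (Q : Poly n) x →
    evalPoly (mulMonomial c e Q) x ≡ (c *F monoEval e x) *F evalPoly Q x
  evalPoly-mulMonomial c e [] x = sym (zeroʳ _)
  evalPoly-mulMonomial c e ((c′ , e′) ∷ Q) x = begin
    ((c *F c′) *F monoEval (e +ₑ e′) x) +F evalPoly (mulMonomial c e Q) x
      ≡⟨ cong₂ _+F_ (cong ((c *F c′) *F_) (monoEval-+ₑ e e′ x)) (evalPoly-mulMonomial c e Q x) ⟩
    ((c *F c′) *F (monoEval e x *F monoEval e′ x)) +F ((c *F monoEval e x) *F evalPoly Q x)
      ≡⟨ cong (_+F ((c *F monoEval e x) *F evalPoly Q x)) (*-interchange c c′ (monoEval e x) (monoEval e′ x)) ⟩
    ((c *F monoEval e x) *F (c′ *F monoEval e′ x)) +F ((c *F monoEval e x) *F evalPoly Q x)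
      ≡⟨ sym (distribˡ _ _ _) ⟩
    (c *F monoEval e x) *F ((c′ *F monoEval e′ x) +F evalPoly Q x) ∎
    where open ≡-Reasoning

  evalPoly-*P : ∀ {n} (P Q : Poly n) x → evalPoly (P *P Q) x ≡ evalPoly P x *F evalPoly Q x
  evalPoly-*P [] Q x = sym (zeroˡ _)
  evalPoly-*P ((c , e) ∷ P) Q x = trans (evalPoly-++ (mulMonomial c e Q) (P *P Q) x)
    (trans (cong₂ _+F_ (evalPoly-mulMonomial c e Q x) (evalPoly-*P P Q x)) (sym (distribʳ _ _ _)))

  evalPoly-ΠP : ∀ {n m} (F : Fin m → Poly n) x → evalPoly (ΠP F) x ≡ ΠF (λ i → evalPoly (F i) x)
  evalPoly-ΠP {m = zero} F x = evalPoly-1P x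
  evalPoly-ΠP {m = suc m} F x = trans (evalPoly-*P (F Fin.zero) (ΠP (λ i → F (Fin.suc i))) x)
    (cong (evalPoly (F Fin.zero) x *F_) (evalPoly-ΠP (λ i → F (Fin.suc i)) x))

  DegreeAtMost : ∀ {n} → ℕ → Poly n → Set
  DegreeAtMost D = All (λ m → totalDeg (proj₂ m) ≤ D)

  degree≤-weaken : ∀ {n} {D D′} {P : Poly n} → D ≤ D′ → DegreeAtMost D P → DegreeAtMost D′ P
  degree≤-weaken D≤D′ = All.map (λ d≤D → ℕₚ.≤-trans d≤D D≤D′)

  degree≤-polyDeg : ∀ {n} (P : Poly n) → DegreeAtMost (polyDeg P) P
  degree≤-polyDeg [] = []
  degree≤-polyDeg ((c , e) ∷ P) = ℕₚ.m≤m⊔n _ _ ∷ degree≤-weaken (ℕₚ.m≤n⊔m _ _) (degree≤-polyDeg P)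

  polyDeg≤ : ∀ {n} {D} (P : Poly n) → DegreeAtMost D P → polyDeg P ≤ D
  polyDeg≤ [] _ = z≤n
  polyDeg≤ ((c , e) ∷ P) (d≤D ∷ P≤D) = ℕₚ.⊔-lub d≤D (polyDeg≤ P P≤D)

  degree≤-1P : ∀ {n} → DegreeAtMost {n} 0 1P
  degree≤-1P {n} = ℕₚ.≤-reflexive (totalDeg-0ₑ {n}) ∷ []

  degree≤-scaleP : ∀ {n} {D} c (Q : Poly n) → DegreeAtMost D Q → DegreeAtMost D (scaleP c Q)
  degree≤-scaleP c [] _ = []
  degree≤-scaleP c (m ∷ Q) (d≤D ∷ Q≤D) = d≤D ∷ degree≤-scaleP c Q Q≤D

  degree≤-mulMonomial : ∀ {n} {a b} c (e : Exps n) (Q : Poly n) → totalDeg e ≤ a →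
    DegreeAtMost b Q → DegreeAtMost (a + b) (mulMonomial c e Q)
  degree≤-mulMonomial c e [] _ _ = []
  degree≤-mulMonomial c e ((c′ , e′) ∷ Q) e≤a (e′≤b ∷ Q≤b) =
    subst (_≤ _) (sym (totalDeg-+ₑ e e′)) (ℕₚ.+-mono-≤ e≤a e′≤b) ∷ degree≤-mulMonomial c e Q e≤a Q≤b

  degree≤-*P : ∀ {n} {a b} (P Q : Poly n) → DegreeAtMost a P → DegreeAtMost b Q → DegreeAtMost (a + b) (P *P Q)
  degree≤-*P [] Q _ _ = []
  degree≤-*P ((c , e) ∷ P) Q (e≤a ∷ P≤a) Q≤b = Allₚ.++⁺ (degree≤-mulMonomial c e Q e≤a Q≤b) (degree≤-*P P Q P≤a Q≤b)

  degree≤-ΠP : ∀ {n m} (F : Fin m → Poly n) (ds : Fin m → ℕ) →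
    (∀ i → DegreeAtMost (ds i) (F i)) → DegreeAtMost (sumℕF ds) (ΠP F)
  degree≤-ΠP {m = zero} F ds h = degree≤-1P
  degree≤-ΠP {m = suc m} F ds h =
    degree≤-*P _ _ (h Fin.zero) (degree≤-ΠP (λ i → F (Fin.suc i)) (λ i → ds (Fin.suc i)) (λ i → h (Fin.suc i)))

  unitₑ : ∀ {n} → Fin n → Exps n
  unitₑ Fin.zero = 1 ◂ 0ₑ
  unitₑ (Fin.suc i) = 0 ◂ unitₑ i

  monoEval-unitₑ : ∀ {n} (i : Fin n) x → monoEval (unitₑ i) x ≡ x i
  monoEval-unitₑ Fin.zero x = trans (cong₂ _*F_ (*-identityʳ (x Fin.zero)) (monoEval-0ₑ (λ i → x (Fin.suc i)))) (*-identityʳ _)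
  monoEval-unitₑ (Fin.suc i) x = trans (*-identityˡ _) (monoEval-unitₑ i (λ j → x (Fin.suc j)))

  totalDeg-unitₑ : ∀ {n} (i : Fin n) → totalDeg (unitₑ i) ≡ 1
  totalDeg-unitₑ {suc n} Fin.zero = cong suc (totalDeg-0ₑ {n})
  totalDeg-unitₑ (Fin.suc i) = totalDeg-unitₑ i

  constP : ∀ {n} → Carrier → Poly n
  constP c = (c , 0ₑ) ∷ []

  varP : ∀ {n} → Fin n → Poly n
  varP i = (1F , unitₑ i) ∷ []

  evalPoly-constP : ∀ {n} c (x : Vecq n) → evalPoly (constP c) x ≡ c
  evalPoly-constP c x = trans (+-identityʳ _) (trans (cong (c *F_) (monoEval-0ₑ x)) (*-identityʳ c))

  evalPoly-varP : ∀ {n} (i : Fin n) x → evalPoly (varP i) x ≡ x i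
  evalPoly-varP i x = trans (+-identityʳ _) (trans (*-identityˡ _) (monoEval-unitₑ i x))

  Homogeneous : ∀ {n} → ℕ → Poly n → Set
  Homogeneous s = All (λ m → totalDeg (proj₂ m) ≡ s)

  homogeneous-constP : ∀ {n} c → Homogeneous 0 (constP {n} c)
  homogeneous-constP {n} c = totalDeg-0ₑ {n} ∷ []

  homogeneous-varP : ∀ {n} (i : Fin n) → Homogeneous 1 (varP i)
  homogeneous-varP i = totalDeg-unitₑ i ∷ []

  homogeneous-scaleP : ∀ {n} {s} c (Q : Poly n) → Homogeneous s Q → Homogeneous s (scaleP c Q)
  homogeneous-scaleP c [] _ = []
  homogeneous-scaleP c (m ∷ Q) (h ∷ hs) = h ∷ homogeneous-scaleP c Q hs

  homogeneous-*P : ∀ {n} {s t} (P Q : Poly n) → Homogeneous s P → Homogeneous t Q → Homogeneous (s + t) (P *P Q)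
  homogeneous-*P [] Q _ _ = []
  homogeneous-*P ((c , e) ∷ P) Q (e≡s ∷ P-hom) Q-hom = Allₚ.++⁺ (mulMonomial-hom Q Q-hom) (homogeneous-*P P Q P-hom Q-hom)
    where
    mulMonomial-hom : ∀ R → Homogeneous _ R → Homogeneous _ (mulMonomial c e R)
    mulMonomial-hom [] _ = []
    mulMonomial-hom ((c′ , e′) ∷ R) (e′≡t ∷ R-hom) =
      trans (totalDeg-+ₑ e e′) (cong₂ _+_ e≡s e′≡t) ∷ mulMonomial-hom R R-hom

  homogeneous-origin : ∀ {n} {s} (Q : Poly n) → 0 < s → Homogeneous s Q → evalPoly Q (λ _ → 0F) ≡ 0F
  homogeneous-origin [] _ _ = refl
  homogeneous-origin ((c , e) ∷ Q) s>0 (e≡s ∷ Q-hom) =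
    trans (cong₂ _+F_ (y≡0⇒x*y≡0 c (monoEval-origin e (subst (0 <_) (sym e≡s) s>0))) (homogeneous-origin Q s>0 Q-hom))
          (+-identityˡ 0F)
    where
    monoEval-origin : ∀ {n} (e : Exps n) → 0 < totalDeg e → monoEval e (λ _ → 0F) ≡ 0F
    monoEval-origin {suc n} e deg>0 with e Fin.zero
    ... | suc e₀ = x≡0⇒x*y≡0 _ (zeroˡ _)
    ... | zero = trans (*-identityˡ _) (monoEval-origin (λ i → e (Fin.suc i)) deg>0)

  homogeneous⇒degree≤ : ∀ {n} {s} (Q : Poly n) → Homogeneous s Q → polyDeg Q ≤ s
  homogeneous⇒degree≤ Q Q-hom = polyDeg≤ Q (All.map ℕₚ.≤-reflexive Q-hom)

  ΣV : ∀ n → (Vecq n → Carrier) → Carrier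
  ΣV zero h = h (λ ())
  ΣV (suc n) h = ΣC (λ c → ΣV n (λ y → h (c ◂ y)))

  ΣV-cong : ∀ n {h h′ : Vecq n → Carrier} → (∀ x → h x ≡ h′ x) → ΣV n h ≡ ΣV n h′
  ΣV-cong zero h≗h′ = h≗h′ (λ ())
  ΣV-cong (suc n) h≗h′ = ΣC-cong (λ c → ΣV-cong n (λ y → h≗h′ (c ◂ y)))

  ΣV-+ : ∀ n (h h′ : Vecq n → Carrier) → ΣV n (λ x → h x +F h′ x) ≡ ΣV n h +F ΣV n h′
  ΣV-+ zero h h′ = refl
  ΣV-+ (suc n) h h′ = trans (ΣC-cong (λ c → ΣV-+ n (λ y → h (c ◂ y)) (λ y → h′ (c ◂ y))))
    (ΣF-+ (λ i → ΣV n (λ y → h (toF i ◂ y))) (λ i → ΣV n (λ y → h′ (toF i ◂ y))))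

  ΣV-*ˡ : ∀ n c (h : Vecq n → Carrier) → ΣV n (λ x → c *F h x) ≡ c *F ΣV n h
  ΣV-*ˡ zero c h = refl
  ΣV-*ˡ (suc n) c h = trans (ΣC-cong (λ c′ → ΣV-*ˡ n c (λ y → h (c′ ◂ y)))) (ΣF-*ˡ c (λ i → ΣV n (λ y → h (toF i ◂ y))))

  ΣV-zero : ∀ n → ΣV n (λ _ → 0F) ≡ 0F
  ΣV-zero zero = refl
  ΣV-zero (suc n) = trans (ΣC-cong {h′ = λ _ → 0F} (λ c → ΣV-zero n)) (ΣF-zero {q} (λ _ → 0F) (λ _ → refl))

  ΣV-monoEval-suc : ∀ n (e : Exps (suc n)) →
    ΣV (suc n) (monoEval e) ≡ ΣC (λ c → c ^F e Fin.zero) *F ΣV n (monoEval (λ i → e (Fin.suc i)))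
  ΣV-monoEval-suc n e = trans (ΣC-cong (λ c → ΣV-*ˡ n (c ^F e Fin.zero) (monoEval (λ i → e (Fin.suc i)))))
    (ΣF-*ʳ (ΣV n (monoEval (λ i → e (Fin.suc i)))) (λ i → toF i ^F e Fin.zero))

  -- Some variable has exponent below q - 1, and its power sum vanishes.
  ΣV-monoEval : ∀ n (e : Exps n) → totalDeg e < n * (q ∸ 1) → ΣV n (monoEval e) ≡ 0F
  ΣV-monoEval zero e ()
  ΣV-monoEval (suc n) e deg< with e Fin.zero ℕₚ.<? q ∸ 1
  ... | yes e₀<q-1 = trans (ΣV-monoEval-suc n e) (x≡0⇒x*y≡0 _ (ΣC-^ (e Fin.zero) e₀<q-1))
  ... | no e₀≮q-1 = trans (ΣV-monoEval-suc n e) (y≡0⇒x*y≡0 _ (ΣV-monoEval n _ tail<))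
    where
    tail< : totalDeg (λ i → e (Fin.suc i)) < n * (q ∸ 1)
    tail< = ℕₚ.+-cancelˡ-< (q ∸ 1) _ _
      (ℕₚ.≤-<-trans (ℕₚ.+-monoˡ-≤ (totalDeg (λ i → e (Fin.suc i))) (ℕₚ.≮⇒≥ e₀≮q-1)) deg<)

  ΣV-evalPoly : ∀ n {D} (P : Poly n) → DegreeAtMost D P → D < n * (q ∸ 1) → ΣV n (evalPoly P) ≡ 0F
  ΣV-evalPoly n [] _ _ = ΣV-zero n
  ΣV-evalPoly n ((c , e) ∷ P) (e≤D ∷ P≤D) D< = begin
    ΣV n (λ x → (c *F monoEval e x) +F evalPoly P x)      ≡⟨ ΣV-+ n (λ x → c *F monoEval e x) (evalPoly P) ⟩
    ΣV n (λ x → c *F monoEval e x) +F ΣV n (evalPoly P)   ≡⟨ cong₂ _+F_ (ΣV-*ˡ n c (monoEval e)) (ΣV-evalPoly n P P≤D D<) ⟩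
    (c *F ΣV n (monoEval e)) +F 0F                        ≡⟨ cong (λ z → (c *F z) +F 0F) (ΣV-monoEval n e (ℕₚ.≤-<-trans e≤D D<)) ⟩
    (c *F 0F) +F 0F                                       ≡⟨ trans (+-identityʳ _) (zeroʳ c) ⟩
    0F                                                    ∎
    where open ≡-Reasoning

  -- Chevalley–Warning

  vanishingFactor : ∀ {n} → Carrier → Poly n → Poly n
  vanishingFactor c P with c ≟ 0F
  ... | yes _ = 1P
  ... | no c≢0 = 1P ++ scaleP (-F (c ⁻¹⟨ c≢0 ⟩)) P

  vanishingFactorDegree : Carrier → ℕ → ℕ
  vanishingFactorDegree c D with c ≟ 0F
  ... | yes _ = 0
  ... | no _ = D

  -- The product of 1 - P/c over all c ≠ 0 is 1 where P vanishes and 0 elsewhere.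
  zeroIndicator : ∀ {n} → Poly n → Poly n
  zeroIndicator P = ΠP (λ i → vanishingFactor (toF i) P)

  evalPoly-vanishingFactor-zero : ∀ {n} c (P : Poly n) x → evalPoly P x ≡ 0F → evalPoly (vanishingFactor c P) x ≡ 1F
  evalPoly-vanishingFactor-zero c P x P[x]≡0 with c ≟ 0F
  ... | yes _ = evalPoly-1P x
  ... | no c≢0 = begin
    evalPoly (1P ++ scaleP c⁻ P) x               ≡⟨ evalPoly-++ 1P (scaleP c⁻ P) x ⟩
    evalPoly 1P x +F evalPoly (scaleP c⁻ P) x    ≡⟨ cong₂ _+F_ (evalPoly-1P x) (evalPoly-scaleP c⁻ P x) ⟩
    1F +F (c⁻ *F evalPoly P x)                   ≡⟨ cong (1F +F_) (y≡0⇒x*y≡0 c⁻ P[x]≡0) ⟩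
    1F +F 0F                                     ≡⟨ +-identityʳ 1F ⟩
    1F                                           ∎
    where open ≡-Reasoning
          c⁻ = -F (c ⁻¹⟨ c≢0 ⟩)

  evalPoly-vanishingFactor-value : ∀ {n} (P : Poly n) x → ¬ evalPoly P x ≡ 0F →
    evalPoly (vanishingFactor (evalPoly P x) P) x ≡ 0F
  evalPoly-vanishingFactor-value P x P[x]≢0 with evalPoly P x ≟ 0F
  ... | yes P[x]≡0 = ⊥-elim (P[x]≢0 P[x]≡0)
  ... | no c≢0 = begin
    evalPoly (1P ++ scaleP (-F c⁻¹) P) x         ≡⟨ evalPoly-++ 1P (scaleP (-F c⁻¹) P) x ⟩
    evalPoly 1P x +F evalPoly (scaleP (-F c⁻¹) P) x ≡⟨ cong₂ _+F_ (evalPoly-1P x) (evalPoly-scaleP (-F c⁻¹) P x) ⟩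
    1F +F ((-F c⁻¹) *F c)                        ≡⟨ cong (1F +F_) (sym (-‿distribˡ-* c⁻¹ c)) ⟩
    1F +F (-F (c⁻¹ *F c))                        ≡⟨ cong (λ z → 1F +F (-F z)) (trans (*-comm c⁻¹ c) (x*x⁻¹≡1 c c≢0)) ⟩
    1F +F (-F 1F)                                ≡⟨ -‿inverseʳ 1F ⟩
    0F                                           ∎
    where open ≡-Reasoning
          c = evalPoly P x
          c⁻¹ = c ⁻¹⟨ c≢0 ⟩

  evalPoly-zeroIndicator-zero : ∀ {n} (P : Poly n) x → evalPoly P x ≡ 0F → evalPoly (zeroIndicator P) x ≡ 1F
  evalPoly-zeroIndicator-zero P x P[x]≡0 = trans (evalPoly-ΠP (λ i → vanishingFactor (toF i) P) x)
    (ΠF-one _ (λ i → evalPoly-vanishingFactor-zero (toF i) P x P[x]≡0))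

  evalPoly-zeroIndicator-nonzero : ∀ {n} (P : Poly n) x → ¬ evalPoly P x ≡ 0F → evalPoly (zeroIndicator P) x ≡ 0F
  evalPoly-zeroIndicator-nonzero P x P[x]≢0 = trans (evalPoly-ΠP (λ i → vanishingFactor (toF i) P) x)
    (ΠF-zero _ (fromF (evalPoly P x))
      (trans (cong (λ c → evalPoly (vanishingFactor c P) x) (toF-fromF _)) (evalPoly-vanishingFactor-value P x P[x]≢0)))

  degree≤-vanishingFactor : ∀ {n} {D} c (P : Poly n) → DegreeAtMost D P →
    DegreeAtMost (vanishingFactorDegree c D) (vanishingFactor c P)
  degree≤-vanishingFactor c P P≤D with c ≟ 0F
  ... | yes _ = degree≤-1P
  ... | no _ = Allₚ.++⁺ (degree≤-weaken z≤n degree≤-1P) (degree≤-scaleP _ P P≤D)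

  vanishingFactorDegree≤ : ∀ c D → vanishingFactorDegree c D ≤ D
  vanishingFactorDegree≤ c D with c ≟ 0F
  ... | yes _ = z≤n
  ... | no _ = ℕₚ.≤-refl

  vanishingFactorDegree-0 : ∀ D → vanishingFactorDegree 0F D ≡ 0
  vanishingFactorDegree-0 D with 0F ≟ 0F
  ... | yes _ = refl
  ... | no 0≢0 = ⊥-elim (0≢0 refl)

  sumℕF-+-≤ : ∀ {m} (g : Fin m → ℕ) {D} i₀ → (∀ i → g i ≤ D) → g i₀ ≡ 0 → sumℕF g + D ≤ m * D
  sumℕF-+-≤ {suc m} g {D} Fin.zero g≤D g₀≡0 = begin
    g Fin.zero + sumℕF (λ i → g (Fin.suc i)) + D ≡⟨ cong (λ z → z + sumℕF (λ i → g (Fin.suc i)) + D) g₀≡0 ⟩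
    sumℕF (λ i → g (Fin.suc i)) + D             ≡⟨ ℕₚ.+-comm _ D ⟩
    D + sumℕF (λ i → g (Fin.suc i))             ≤⟨ ℕₚ.+-monoʳ-≤ D (sumℕF≤ m (λ i → g (Fin.suc i)) (λ i → g≤D (Fin.suc i))) ⟩
    D + m * D                                   ∎
    where
    open ℕₚ.≤-Reasoning
    sumℕF≤ : ∀ m (g : Fin m → ℕ) → (∀ i → g i ≤ D) → sumℕF g ≤ m * D
    sumℕF≤ zero g _ = z≤n
    sumℕF≤ (suc m) g g≤D = ℕₚ.+-mono-≤ (g≤D Fin.zero) (sumℕF≤ m (λ i → g (Fin.suc i)) (λ i → g≤D (Fin.suc i)))
  sumℕF-+-≤ {suc m} g {D} (Fin.suc i₀) g≤D gᵢ₀≡0 = begin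
    g Fin.zero + sumℕF (λ i → g (Fin.suc i)) + D   ≡⟨ ℕₚ.+-assoc (g Fin.zero) _ D ⟩
    g Fin.zero + (sumℕF (λ i → g (Fin.suc i)) + D) ≤⟨ ℕₚ.+-mono-≤ (g≤D Fin.zero) (sumℕF-+-≤ (λ i → g (Fin.suc i)) i₀ (λ i → g≤D (Fin.suc i)) gᵢ₀≡0) ⟩
    D + m * D                                     ∎
    where open ℕₚ.≤-Reasoning

  -- Only q - 1 factors have degree D: the one at c = 0 is the constant 1.
  degree≤-zeroIndicator : ∀ {n} {D} (P : Poly n) → DegreeAtMost D P → DegreeAtMost ((q ∸ 1) * D) (zeroIndicator P)
  degree≤-zeroIndicator {D = D} P P≤D =
    degree≤-weaken Σd≤ (degree≤-ΠP _ d (λ i → degree≤-vanishingFactor (toF i) P P≤D))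
    where
    d : Fin q → ℕ
    d i = vanishingFactorDegree (toF i) D
    Σd+D≤ : sumℕF d + D ≤ q * D
    Σd+D≤ = sumℕF-+-≤ d (fromF 0F) (λ i → vanishingFactorDegree≤ (toF i) D)
              (trans (cong (λ c → vanishingFactorDegree c D) (toF-fromF 0F)) (vanishingFactorDegree-0 D))
    Σd≤ : sumℕF d ≤ (q ∸ 1) * D
    Σd≤ = ℕₚ.+-cancelʳ-≤ D _ _ (subst (sumℕF d + D ≤_)
            (trans (cong (_* D) (sym (ℕₚ.m+[n∸m]≡n (ℕₚ.≤-trans (s≤s z≤n) 2≤q)))) (ℕₚ.+-comm D _)) Σd+D≤)

  degreeSum : ∀ {n} → List (Poly n) → ℕ
  degreeSum [] = 0
  degreeSum (P ∷ Ps) = polyDeg P + degreeSum Ps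

  commonZeroIndicator : ∀ {n} → List (Poly n) → Poly n
  commonZeroIndicator [] = 1P
  commonZeroIndicator (P ∷ Ps) = zeroIndicator P *P commonZeroIndicator Ps

  CommonZero : ∀ {n} → List (Poly n) → Vecq n → Set
  CommonZero Ps x = All (λ P → evalPoly P x ≡ 0F) Ps

  degree≤-commonZeroIndicator : ∀ {n} (Ps : List (Poly n)) →
    DegreeAtMost ((q ∸ 1) * degreeSum Ps) (commonZeroIndicator Ps)
  degree≤-commonZeroIndicator {n} [] = subst (λ D → DegreeAtMost D (1P {n})) (sym (ℕₚ.*-zeroʳ (q ∸ 1))) degree≤-1P
  degree≤-commonZeroIndicator (P ∷ Ps) =
    subst (λ D → DegreeAtMost D (commonZeroIndicator (P ∷ Ps))) (sym (ℕₚ.*-distribˡ-+ (q ∸ 1) (polyDeg P) (degreeSum Ps)))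
      (degree≤-*P _ _ (degree≤-zeroIndicator P (degree≤-polyDeg P)) (degree≤-commonZeroIndicator Ps))

  evalPoly-commonZeroIndicator-zero : ∀ {n} (Ps : List (Poly n)) x → CommonZero Ps x →
    evalPoly (commonZeroIndicator Ps) x ≡ 1F
  evalPoly-commonZeroIndicator-zero [] x _ = evalPoly-1P x
  evalPoly-commonZeroIndicator-zero (P ∷ Ps) x (P[x]≡0 ∷ Ps[x]≡0) =
    trans (evalPoly-*P (zeroIndicator P) (commonZeroIndicator Ps) x)
      (trans (cong₂ _*F_ (evalPoly-zeroIndicator-zero P x P[x]≡0) (evalPoly-commonZeroIndicator-zero Ps x Ps[x]≡0))
             (*-identityˡ 1F))

  evalPoly-commonZeroIndicator-nonzero : ∀ {n} (Ps : List (Poly n)) x → ¬ CommonZero Ps x →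
    evalPoly (commonZeroIndicator Ps) x ≡ 0F
  evalPoly-commonZeroIndicator-nonzero [] x ¬zero = ⊥-elim (¬zero [])
  evalPoly-commonZeroIndicator-nonzero (P ∷ Ps) x ¬zero =
    trans (evalPoly-*P (zeroIndicator P) (commonZeroIndicator Ps) x) (product≡0 (evalPoly P x ≟ 0F))
    where
    product≡0 : Dec (evalPoly P x ≡ 0F) → evalPoly (zeroIndicator P) x *F evalPoly (commonZeroIndicator Ps) x ≡ 0F
    product≡0 (yes P[x]≡0) = y≡0⇒x*y≡0 _ (evalPoly-commonZeroIndicator-nonzero Ps x (λ zs → ¬zero (P[x]≡0 ∷ zs)))
    product≡0 (no P[x]≢0) = x≡0⇒x*y≡0 _ (evalPoly-zeroIndicator-nonzero P x P[x]≢0)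

  isZero : Carrier → Carrier
  isZero c with c ≟ 0F
  ... | yes _ = 1F
  ... | no _ = 0F

  isZero-zero : ∀ {c} → c ≡ 0F → isZero c ≡ 1F
  isZero-zero {c} c≡0 with c ≟ 0F
  ... | yes _ = refl
  ... | no c≢0 = ⊥-elim (c≢0 c≡0)

  isZero-nonzero : ∀ {c} → ¬ c ≡ 0F → isZero c ≡ 0F
  isZero-nonzero {c} c≢0 with c ≟ 0F
  ... | yes c≡0 = ⊥-elim (c≢0 c≡0)
  ... | no _ = refl

  isOrigin : ∀ {n} → Vecq n → Carrier
  isOrigin x = ΠF (λ i → isZero (x i))

  ΣC-isZero : ΣC isZero ≡ 1F
  ΣC-isZero = trans (ΣF-single (λ i → isZero (toF i)) (fromF 0F) others) (isZero-zero (toF-fromF 0F))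
    where
    others : ∀ i → ¬ i ≡ fromF 0F → isZero (toF i) ≡ 0F
    others i i≢0 = isZero-nonzero (λ toFi≡0 → i≢0 (trans (sym (fromF-toF i)) (cong fromF toFi≡0)))

  ΣV-isOrigin : ∀ n → ΣV n isOrigin ≡ 1F
  ΣV-isOrigin zero = refl
  ΣV-isOrigin (suc n) = trans (ΣC-cong {h′ = isZero} split) ΣC-isZero
    where split : ∀ c → ΣV n (λ y → isZero c *F isOrigin y) ≡ isZero c
          split c = trans (ΣV-*ˡ n (isZero c) isOrigin) (trans (cong (isZero c *F_) (ΣV-isOrigin n)) (*-identityʳ _))

  isOrigin-origin : ∀ {n} (x : Vecq n) → (∀ i → x i ≡ 0F) → isOrigin x ≡ 1F
  isOrigin-origin x x≡0 = ΠF-one _ (λ i → isZero-zero (x≡0 i))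

  isOrigin-nonorigin : ∀ {n} (x : Vecq n) i → ¬ x i ≡ 0F → isOrigin x ≡ 0F
  isOrigin-nonorigin x i xᵢ≢0 = ΠF-zero _ i (isZero-nonzero xᵢ≢0)

  ∃?-Vecq : ∀ n (Q : Vecq n → Set) → (∀ x → Dec (Q x)) → (∀ {x y} → (∀ i → x i ≡ y i) → Q x → Q y) → Dec (∃ Q)
  ∃?-Vecq zero Q Q? Q-resp with Q? (λ ())
  ... | yes q₀ = yes ((λ ()) , q₀)
  ... | no ¬q₀ = no (λ { (x , qx) → ¬q₀ (Q-resp (λ ()) qx) })
  ∃?-Vecq (suc n) Q Q? Q-resp with Finₚ.any? (λ i → ∃?-Vecq n (λ y → Q (toF i ◂ y)) (λ y → Q? (toF i ◂ y))
                                                  (λ y≗y′ → Q-resp (λ { Fin.zero → refl ; (Fin.suc j) → y≗y′ j })))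
  ... | yes (i , y , qy) = yes ((toF i ◂ y) , qy)
  ... | no ¬∃ = no (λ { (x , qx) → ¬∃ (fromF (x Fin.zero) , (λ i → x (Fin.suc i)) ,
                          Q-resp (λ { Fin.zero → sym (toF-fromF (x Fin.zero)) ; (Fin.suc i) → refl }) qx) })

  NontrivialCommonZero : ∀ {n} → List (Poly n) → Vecq n → Set
  NontrivialCommonZero Ps x = (∃ λ i → ¬ x i ≡ 0F) × CommonZero Ps x

  nontrivialCommonZero? : ∀ {n} (Ps : List (Poly n)) x → Dec (NontrivialCommonZero Ps x)
  nontrivialCommonZero? Ps x = Finₚ.any? (λ i → ¬? (x i ≟ 0F)) ×-dec All.all? (λ P → evalPoly P x ≟ 0F) Ps

  nontrivialCommonZero-resp : ∀ {n} (Ps : List (Poly n)) {x y} → (∀ i → x i ≡ y i) →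
    NontrivialCommonZero Ps x → NontrivialCommonZero Ps y
  nontrivialCommonZero-resp Ps x≗y ((i , xᵢ≢0) , zs) =
    (i , (λ yᵢ≡0 → xᵢ≢0 (trans (x≗y i) yᵢ≡0))) , All.map (λ {P} P[x]≡0 → trans (sym (evalPoly-cong P x≗y)) P[x]≡0) zs

  -- If the polynomials had no common zero besides 0, their common-zero indicator would
  -- agree with isOrigin, yet the former sums to 0 by its low degree and the latter to 1.
  chevalley-warning : ∀ n (Ps : List (Poly n)) → CommonZero Ps (λ _ → 0F) → degreeSum Ps < n →
    Σ (Vecq n) (NontrivialCommonZero Ps)
  chevalley-warning n Ps origin-zero deg<
    with ∃?-Vecq n (NontrivialCommonZero Ps) (nontrivialCommonZero? Ps) (nontrivialCommonZero-resp Ps)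
  ... | yes found = found
  ... | no none = ⊥-elim (1≢0 (begin
    1F                                          ≡⟨ sym (ΣV-isOrigin n) ⟩
    ΣV n isOrigin                               ≡⟨ ΣV-cong n (λ x → sym (indicator≡isOrigin x (Finₚ.all? (λ i → x i ≟ 0F)))) ⟩
    ΣV n (evalPoly (commonZeroIndicator Ps))    ≡⟨ ΣV-evalPoly n _ (degree≤-commonZeroIndicator Ps) deg-small ⟩
    0F                                          ∎))
    where
    open ≡-Reasoning
    indicator≡isOrigin : ∀ x → Dec (∀ i → x i ≡ 0F) → evalPoly (commonZeroIndicator Ps) x ≡ isOrigin x
    indicator≡isOrigin x (yes x≡0) = trans (evalPoly-cong (commonZeroIndicator Ps) x≡0)
      (trans (evalPoly-commonZeroIndicator-zero Ps _ origin-zero) (sym (isOrigin-origin x x≡0)))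
    indicator≡isOrigin x (no x≢0) = trans (evalPoly-commonZeroIndicator-nonzero Ps x (λ zs → none (x , (i , xᵢ≢0) , zs)))
                                          (sym (isOrigin-nonorigin x i xᵢ≢0))
      where
      witness = Finₚ.¬∀⟶∃¬ n (λ i → x i ≡ 0F) (λ i → x i ≟ 0F) x≢0
      i = proj₁ witness
      xᵢ≢0 = proj₂ witness
    deg-small : (q ∸ 1) * degreeSum Ps < n * (q ∸ 1)
    deg-small = subst (_< n * (q ∸ 1)) (ℕₚ.*-comm (degreeSum Ps) (q ∸ 1))
                  (ℕₚ.*-monoˡ-< (q ∸ 1) {{ℕ.>-nonZero (ℕₚ.∸-monoˡ-≤ 1 2≤q)}} deg<)

  -- Polynomials in m variables with coefficients polynomials in n variables

  PolyOver : ℕ → ℕ → Set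
  PolyOver m n = List (Exps m × Poly n)

  evalTerm : ∀ {m n} → Exps m × Poly n → Vecq m → Vecq n → Carrier
  evalTerm (A , Q) a v = monoEval A a *F evalPoly Q v

  evalOver : ∀ {m n} → PolyOver m n → Vecq m → Vecq n → Carrier
  evalOver [] a v = 0F
  evalOver (t ∷ M) a v = evalTerm t a v +F evalOver M a v

  1O : ∀ {m n} → PolyOver m n
  1O = (0ₑ , 1P) ∷ []

  scaleO : ∀ {m n} → Carrier → PolyOver m n → PolyOver m n
  scaleO c = List.map (λ { (A , Q) → A , scaleP c Q })

  mulTermO : ∀ {m n} → Exps m × Poly n → PolyOver m n → PolyOver m n
  mulTermO (A , Q) = List.map (λ { (B , R) → A +ₑ B , Q *P R })

  infixl 7 _*O_
  _*O_ : ∀ {m n} → PolyOver m n → PolyOver m n → PolyOver m n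
  [] *O M′ = []
  (t ∷ M) *O M′ = mulTermO t M′ ++ M *O M′

  infixr 8 _^O_
  _^O_ : ∀ {m n} → PolyOver m n → ℕ → PolyOver m n
  M ^O zero = 1O
  M ^O suc e = M *O (M ^O e)

  ΠO : ∀ {m n k} → (Fin k → PolyOver m n) → PolyOver m n
  ΠO {k = zero} F = 1O
  ΠO {k = suc k} F = F Fin.zero *O ΠO (λ i → F (Fin.suc i))

  evalOver-++ : ∀ {m n} (M M′ : PolyOver m n) a v → evalOver (M ++ M′) a v ≡ evalOver M a v +F evalOver M′ a v
  evalOver-++ [] M′ a v = sym (+-identityˡ _)
  evalOver-++ (t ∷ M) M′ a v = trans (cong (evalTerm t a v +F_) (evalOver-++ M M′ a v)) (sym (+-assoc _ _ _))

  evalOver-tabulate : ∀ {m n r} (g : Fin r → Exps m × Poly n) a v → evalOver (List.tabulate g) a v ≡ ΣF (λ l → evalTerm (g l) a v)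
  evalOver-tabulate {r = zero} g a v = refl
  evalOver-tabulate {r = suc r} g a v = cong (evalTerm (g Fin.zero) a v +F_) (evalOver-tabulate (λ l → g (Fin.suc l)) a v)

  evalOver-1O : ∀ {m n} (a : Vecq m) (v : Vecq n) → evalOver 1O a v ≡ 1F
  evalOver-1O a v = trans (+-identityʳ _) (trans (cong₂ _*F_ (monoEval-0ₑ a) (evalPoly-1P v)) (*-identityˡ 1F))

  evalOver-scaleO : ∀ {m n} c (M : PolyOver m n) a v → evalOver (scaleO c M) a v ≡ c *F evalOver M a v
  evalOver-scaleO c [] a v = sym (zeroʳ c)
  evalOver-scaleO c ((A , Q) ∷ M) a v = trans (cong₂ _+F_ scaled (evalOver-scaleO c M a v)) (sym (distribˡ _ _ _))
    where scaled = trans (cong (monoEval A a *F_) (evalPoly-scaleP c Q v)) (*-left-comm _ c _)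

  evalOver-*O : ∀ {m n} (M M′ : PolyOver m n) a v → evalOver (M *O M′) a v ≡ evalOver M a v *F evalOver M′ a v
  evalOver-*O [] M′ a v = sym (zeroˡ _)
  evalOver-*O ((A , Q) ∷ M) M′ a v = trans (evalOver-++ (mulTermO (A , Q) M′) (M *O M′) a v)
    (trans (cong₂ _+F_ (evalOver-mulTermO M′) (evalOver-*O M M′ a v)) (sym (distribʳ _ _ _)))
    where
    evalOver-mulTermO : ∀ M′ → evalOver (mulTermO (A , Q) M′) a v ≡ (monoEval A a *F evalPoly Q v) *F evalOver M′ a v
    evalOver-mulTermO [] = sym (zeroʳ _)
    evalOver-mulTermO ((B , R) ∷ M′) = trans (cong₂ _+F_ term (evalOver-mulTermO M′)) (sym (distribˡ _ _ _))
      where term = trans (cong₂ _*F_ (monoEval-+ₑ A B a) (evalPoly-*P Q R v))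
                         (*-interchange (monoEval A a) (monoEval B a) (evalPoly Q v) (evalPoly R v))

  evalOver-^O : ∀ {m n} (M : PolyOver m n) e a v → evalOver (M ^O e) a v ≡ evalOver M a v ^F e
  evalOver-^O M zero a v = evalOver-1O a v
  evalOver-^O M (suc e) a v = trans (evalOver-*O M (M ^O e) a v) (cong (evalOver M a v *F_) (evalOver-^O M e a v))

  evalOver-ΠO : ∀ {m n k} (F : Fin k → PolyOver m n) a v → evalOver (ΠO F) a v ≡ ΠF (λ i → evalOver (F i) a v)
  evalOver-ΠO {k = zero} F a v = evalOver-1O a v
  evalOver-ΠO {k = suc k} F a v = trans (evalOver-*O (F Fin.zero) (ΠO (λ i → F (Fin.suc i))) a v)
    (cong (evalOver (F Fin.zero) a v *F_) (evalOver-ΠO (λ i → F (Fin.suc i)) a v))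

  Graded : ∀ {k n} → ℕ → PolyOver (suc k) n → Set
  Graded D = All (λ { (A , Q) → Homogeneous (A Fin.zero) Q × totalDeg A ≤ D })

  graded-weaken : ∀ {k n} {D D′} {M : PolyOver (suc k) n} → D ≤ D′ → Graded D M → Graded D′ M
  graded-weaken D≤D′ = All.map (λ { (hom , A≤D) → hom , ℕₚ.≤-trans A≤D D≤D′ })

  graded-1O : ∀ {k n} → Graded 0 (1O {suc k} {n})
  graded-1O {k} {n} = (totalDeg-0ₑ {n} ∷ [] , ℕₚ.≤-reflexive (totalDeg-0ₑ {suc k})) ∷ []

  graded-scaleO : ∀ {k n} {D} c (M : PolyOver (suc k) n) → Graded D M → Graded D (scaleO c M)
  graded-scaleO c [] _ = []
  graded-scaleO c ((A , Q) ∷ M) ((hom , A≤D) ∷ gr) = (homogeneous-scaleP c Q hom , A≤D) ∷ graded-scaleO c M gr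

  graded-*O : ∀ {k n} {D D′} (M M′ : PolyOver (suc k) n) → Graded D M → Graded D′ M′ → Graded (D + D′) (M *O M′)
  graded-*O [] M′ _ _ = []
  graded-*O {D = D} {D′} ((A , Q) ∷ M) M′ ((hom , A≤D) ∷ gr) gr′ = Allₚ.++⁺ (graded-mulTermO M′ gr′) (graded-*O M M′ gr gr′)
    where
    graded-mulTermO : ∀ M′ → Graded D′ M′ → Graded (D + D′) (mulTermO (A , Q) M′)
    graded-mulTermO [] _ = []
    graded-mulTermO ((B , R) ∷ M′) ((hom′ , B≤D′) ∷ gr′) =
      (homogeneous-*P Q R hom hom′ , subst (_≤ D + D′) (sym (totalDeg-+ₑ A B)) (ℕₚ.+-mono-≤ A≤D B≤D′)) ∷ graded-mulTermO M′ gr′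

  graded-^O : ∀ {k n} (M : PolyOver (suc k) n) e → Graded 1 M → Graded e (M ^O e)
  graded-^O M zero _ = graded-1O
  graded-^O M (suc e) gr = graded-*O M (M ^O e) gr (graded-^O M e gr)

  graded-ΠO : ∀ {k n m} (F : Fin m → PolyOver (suc k) n) (ds : Fin m → ℕ) →
    (∀ i → Graded (ds i) (F i)) → Graded (sumℕF ds) (ΠO F)
  graded-ΠO {m = zero} F ds gr = graded-1O
  graded-ΠO {m = suc m} F ds gr =
    graded-*O _ _ (gr Fin.zero) (graded-ΠO (λ i → F (Fin.suc i)) (λ i → ds (Fin.suc i)) (λ i → gr (Fin.suc i)))

  module Expansion {n k} (u₀ : Vecq n) (vs : Fin k → Vecq n) where

    point : Vecq (suc k) → Vecq n → Vecq n
    point a v = u₀ +V lincomb a (v ◂ vs)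

    -- u₀ᵢ + a₀ vᵢ + Σₗ a₍ₗ₊₁₎ vsₗᵢ as a polynomial in a whose coefficients are polynomials in v.
    linearForm : Fin n → PolyOver (suc k) n
    linearForm i = (0ₑ , constP (u₀ i)) ∷ (unitₑ Fin.zero , varP i) ∷ List.tabulate (λ l → unitₑ (Fin.suc l) , constP (vs l i))

    evalOver-linearForm : ∀ i a v → evalOver (linearForm i) a v ≡ point a v i
    evalOver-linearForm i a v = cong₂ _+F_
      (trans (cong₂ _*F_ (monoEval-0ₑ a) (evalPoly-constP (u₀ i) v)) (*-identityˡ _))
      (cong₂ _+F_ (cong₂ _*F_ (monoEval-unitₑ Fin.zero a) (evalPoly-varP i v))
                  (trans (evalOver-tabulate (λ l → unitₑ (Fin.suc l) , constP (vs l i)) a v)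
                    (ΣF-cong (λ l → cong₂ _*F_ (monoEval-unitₑ (Fin.suc l) a) (evalPoly-constP (vs l i) v)))))

    graded-linearForm : ∀ i → Graded 1 (linearForm i)
    graded-linearForm i = (homogeneous-constP (u₀ i) , ℕₚ.≤-trans (ℕₚ.≤-reflexive (totalDeg-0ₑ {suc k})) z≤n)
                        ∷ (homogeneous-varP i , ℕₚ.≤-reflexive (totalDeg-unitₑ {suc k} Fin.zero))
                        ∷ Allₚ.tabulate⁺ (λ l → homogeneous-constP (vs l i) , ℕₚ.≤-reflexive (totalDeg-unitₑ (Fin.suc l)))

    expand : Poly n → PolyOver (suc k) n
    expand [] = []
    expand ((c , E) ∷ p) = scaleO c (ΠO (λ i → linearForm i ^O E i)) ++ expand p

    evalOver-expand : ∀ p a v → evalOver (expand p) a v ≡ evalPoly p (point a v)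
    evalOver-expand [] a v = refl
    evalOver-expand ((c , E) ∷ p) a v = begin
      evalOver (scaleO c M ++ expand p) a v            ≡⟨ evalOver-++ (scaleO c M) (expand p) a v ⟩
      evalOver (scaleO c M) a v +F evalOver (expand p) a v ≡⟨ cong₂ _+F_ (evalOver-scaleO c M a v) (evalOver-expand p a v) ⟩
      (c *F evalOver M a v) +F evalPoly p (point a v)  ≡⟨ cong (λ z → (c *F z) +F evalPoly p (point a v)) M≡monomial ⟩
      (c *F monoEval E (point a v)) +F evalPoly p (point a v) ∎
      where
      open ≡-Reasoning
      M = ΠO (λ i → linearForm i ^O E i)
      M≡monomial : evalOver M a v ≡ monoEval E (point a v)
      M≡monomial = trans (evalOver-ΠO (λ i → linearForm i ^O E i) a v)
        (ΠF-cong (λ i → trans (evalOver-^O (linearForm i) (E i) a v) (cong (_^F E i) (evalOver-linearForm i a v))))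

    graded-expand : ∀ p → Graded (polyDeg p) (expand p)
    graded-expand [] = []
    graded-expand ((c , E) ∷ p) = Allₚ.++⁺
      (graded-weaken (ℕₚ.m≤m⊔n _ _) (graded-scaleO c _
        (graded-ΠO (λ i → linearForm i ^O E i) E (λ i → graded-^O (linearForm i) (E i) (graded-linearForm i)))))
      (graded-weaken (ℕₚ.m≤n⊔m _ _) (graded-expand p))

  ΣL : ∀ {X : Set} → (X → Carrier) → List X → Carrier
  ΣL f [] = 0F
  ΣL f (x ∷ xs) = f x +F ΣL f xs

  ΣL-++ : ∀ {X : Set} (f : X → Carrier) xs ys → ΣL f (xs ++ ys) ≡ ΣL f xs +F ΣL f ys
  ΣL-++ f [] ys = sym (+-identityˡ _)
  ΣL-++ f (x ∷ xs) ys = trans (cong (f x +F_) (ΣL-++ f xs ys)) (sym (+-assoc _ _ _))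

  ΣL-map : ∀ {X Y : Set} (f : Y → Carrier) (g : X → Y) xs → ΣL f (List.map g xs) ≡ ΣL (λ x → f (g x)) xs
  ΣL-map f g [] = refl
  ΣL-map f g (x ∷ xs) = cong (f (g x) +F_) (ΣL-map f g xs)

  ΣL-cong : ∀ {X : Set} {f g : X → Carrier} xs → (∀ x → f x ≡ g x) → ΣL f xs ≡ ΣL g xs
  ΣL-cong [] f≗g = refl
  ΣL-cong (x ∷ xs) f≗g = cong₂ _+F_ (f≗g x) (ΣL-cong xs f≗g)

  ΣL-zero : ∀ {X : Set} (f : X → Carrier) xs → (∀ x → f x ≡ 0F) → ΣL f xs ≡ 0F
  ΣL-zero f [] f≡0 = refl
  ΣL-zero f (x ∷ xs) f≡0 = trans (cong₂ _+F_ (f≡0 x) (ΣL-zero f xs f≡0)) (+-identityˡ 0F)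

  ΣL-+ : ∀ {X : Set} (f g : X → Carrier) xs → ΣL (λ x → f x +F g x) xs ≡ ΣL f xs +F ΣL g xs
  ΣL-+ f g [] = sym (+-identityˡ _)
  ΣL-+ f g (x ∷ xs) = trans (cong ((f x +F g x) +F_) (ΣL-+ f g xs)) (+-interchange _ _ _ _)

  ΣBelow : ℕ → (ℕ → Carrier) → Carrier
  ΣBelow zero g = 0F
  ΣBelow (suc J) g = ΣBelow J g +F g J

  ΣBelow-zero : ∀ J (g : ℕ → Carrier) → (∀ j → j < J → g j ≡ 0F) → ΣBelow J g ≡ 0F
  ΣBelow-zero zero g _ = refl
  ΣBelow-zero (suc J) g g≡0 = trans (cong₂ _+F_ (ΣBelow-zero J g (λ j j<J → g≡0 j (ℕₚ.m<n⇒m<1+n j<J))) (g≡0 J ℕₚ.≤-refl))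
                                    (+-identityˡ 0F)

  ΣBelow-single : ∀ J (g : ℕ → Carrier) j₀ → j₀ < J → (∀ j → j < J → ¬ j ≡ j₀ → g j ≡ 0F) → ΣBelow J g ≡ g j₀
  ΣBelow-single (suc J) g j₀ j₀<1+J others with j₀ ℕ.≟ J
  ... | yes refl = trans (cong (_+F g J) (ΣBelow-zero J g (λ j j<J → others j (ℕₚ.m<n⇒m<1+n j<J) (ℕₚ.<⇒≢ j<J))))
                         (+-identityˡ _)
  ... | no j₀≢J = trans (cong₂ _+F_ (ΣBelow-single J g j₀ (ℕₚ.≤∧≢⇒< (ℕₚ.≤-pred j₀<1+J) j₀≢J)
                                       (λ j j<J → others j (ℕₚ.m<n⇒m<1+n j<J)))
                                    (others J ℕₚ.≤-refl (λ J≡j₀ → j₀≢J (sym J≡j₀))))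
                        (+-identityʳ _)

  ΣL-blocks : ∀ {m} (f : Exps (suc m) → Carrier) (monos : ℕ → List (Exps m)) D J →
    ΣL f (blocks monos D J) ≡ ΣBelow J (λ j → ΣL (λ B → f ((D ∸ j) ◂ B)) (monos j))
  ΣL-blocks f monos D zero = refl
  ΣL-blocks f monos D (suc J) = trans (ΣL-++ f (blocks monos D J) _)
    (cong₂ _+F_ (ΣL-blocks f monos D J) (ΣL-map f ((D ∸ J) ◂_) (monos J)))

  ifEqual : ∀ {m} → Exps m → Exps m → Carrier → Carrier
  ifEqual A B x with A ≟ₑ B
  ... | yes _ = x
  ... | no _ = 0F

  ifEqual-yes : ∀ {m} {A B : Exps m} x → (∀ i → A i ≡ B i) → ifEqual A B x ≡ x
  ifEqual-yes {A = A} {B} x A≗B with A ≟ₑ B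
  ... | yes _ = refl
  ... | no A≉B = ⊥-elim (A≉B A≗B)

  ifEqual-no : ∀ {m} {A B : Exps m} x → ¬ (∀ i → A i ≡ B i) → ifEqual A B x ≡ 0F
  ifEqual-no {A = A} {B} x A≉B with A ≟ₑ B
  ... | yes A≗B = ⊥-elim (A≉B A≗B)
  ... | no _ = refl

  ifEqual-◂ : ∀ {m} (A : Exps (suc m)) {e} (B : Exps m) y → A Fin.zero ≡ e →
    ifEqual A (e ◂ B) y ≡ ifEqual (λ i → A (Fin.suc i)) B y
  ifEqual-◂ A {e} B y A₀≡e with (λ i → A (Fin.suc i)) ≟ₑ B
  ... | yes A′≗B = ifEqual-yes {A = A} {e ◂ B} y (λ { Fin.zero → A₀≡e ; (Fin.suc i) → A′≗B i })
  ... | no A′≉B = ifEqual-no {A = A} {e ◂ B} y (λ A≗B → A′≉B (λ i → A≗B (Fin.suc i)))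

  -- Every A with |A| ≤ D occurs exactly once in monomialsUpTo m D.
  ΣL-ifEqual : ∀ m D (A : Exps m) → totalDeg A ≤ D → (G : Exps m → Carrier) →
    (∀ B → (∀ i → A i ≡ B i) → G B ≡ G A) → ΣL (λ B → ifEqual A B (G B)) (monomialsUpTo m D) ≡ G A
  ΣL-ifEqual zero D A _ G G-resp = trans (+-identityʳ _) (trans (ifEqual-yes {A = A} {λ ()} _ (λ ())) (G-resp _ (λ ())))
  ΣL-ifEqual (suc m) D A |A|≤D G G-resp = begin
    ΣL f (blocks (monomialsUpTo m) D (suc D))    ≡⟨ ΣL-blocks f (monomialsUpTo m) D (suc D) ⟩
    ΣBelow (suc D) block                         ≡⟨ ΣBelow-single (suc D) block j₀ (s≤s (ℕₚ.m∸n≤m D A₀)) other-blocks ⟩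
    block j₀                                     ≡⟨ ΣL-cong (monomialsUpTo m j₀) (λ B → ifEqual-◂ A B _ (sym D∸j₀≡A₀)) ⟩
    ΣL (λ B → ifEqual A′ B (G′ B)) (monomialsUpTo m j₀) ≡⟨ ΣL-ifEqual m j₀ A′ |A′|≤j₀ G′ (λ B A′≗B → trans (G-resp _ (A≗ B A′≗B)) (sym G′A′≡GA)) ⟩
    G′ A′                                        ≡⟨ G′A′≡GA ⟩
    G A                                          ∎
    where
    open ≡-Reasoning
    f : Exps (suc m) → Carrier
    f B = ifEqual A B (G B)
    block : ℕ → Carrier
    block j = ΣL (λ B → f ((D ∸ j) ◂ B)) (monomialsUpTo m j)
    A₀ = A Fin.zero
    A′ : Exps m
    A′ i = A (Fin.suc i)
    j₀ = D ∸ A₀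
    D∸j₀≡A₀ : D ∸ j₀ ≡ A₀
    D∸j₀≡A₀ = ℕₚ.m∸[m∸n]≡n (ℕₚ.≤-trans (ℕₚ.m≤m+n A₀ _) |A|≤D)
    |A′|≤j₀ : totalDeg A′ ≤ j₀
    |A′|≤j₀ = ℕₚ.m+n≤o⇒m≤o∸n (totalDeg A′) (subst (_≤ D) (ℕₚ.+-comm A₀ (totalDeg A′)) |A|≤D)
    G′ : Exps m → Carrier
    G′ B = G ((D ∸ j₀) ◂ B)
    A≗ : ∀ B → (∀ i → A′ i ≡ B i) → ∀ i → A i ≡ ((D ∸ j₀) ◂ B) i
    A≗ B A′≗B Fin.zero = sym D∸j₀≡A₀
    A≗ B A′≗B (Fin.suc i) = A′≗B i
    G′A′≡GA : G′ A′ ≡ G A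
    G′A′≡GA = G-resp _ (A≗ A′ (λ _ → refl))
    other-blocks : ∀ j → j < suc D → ¬ j ≡ j₀ → block j ≡ 0F
    other-blocks j j≤D j≢j₀ = ΣL-zero _ (monomialsUpTo m j) (λ B → ifEqual-no {A = A} {(D ∸ j) ◂ B} _ (λ A≗ → j≢j₀ (begin
      j             ≡⟨ sym (ℕₚ.m∸[m∸n]≡n (ℕₚ.≤-pred j≤D)) ⟩
      D ∸ (D ∸ j)   ≡⟨ cong (D ∸_) (sym (A≗ Fin.zero)) ⟩
      D ∸ A₀        ∎)))

  ifEqualP : ∀ {m n} → Exps m → Exps m → Poly n → Poly n
  ifEqualP A B Q with A ≟ₑ B
  ... | yes _ = Q
  ... | no _ = []

  evalPoly-ifEqualP : ∀ {m n} (A B : Exps m) (Q : Poly n) v → evalPoly (ifEqualP A B Q) v ≡ ifEqual A B (evalPoly Q v)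
  evalPoly-ifEqualP A B Q v with A ≟ₑ B
  ... | yes _ = refl
  ... | no _ = refl

  coefficient : ∀ {m n} → PolyOver m n → Exps m → Poly n
  coefficient [] B = []
  coefficient ((A , Q) ∷ M) B = ifEqualP A B Q ++ coefficient M B

  regroup : ∀ {m n} D (M : PolyOver m n) → All (λ t → totalDeg (proj₁ t) ≤ D) M → ∀ a v →
    evalOver M a v ≡ ΣL (λ B → monoEval B a *F evalPoly (coefficient M B) v) (monomialsUpTo m D)
  regroup {m} D [] _ a v = sym (ΣL-zero _ (monomialsUpTo m D) (λ B → zeroʳ _))
  regroup {m} D ((A , Q) ∷ M) (|A|≤D ∷ M≤D) a v = sym (begin
    ΣL (λ B → monoEval B a *F evalPoly (ifEqualP A B Q ++ coefficient M B) v) Bs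
      ≡⟨ ΣL-cong Bs (λ B → trans (cong (monoEval B a *F_) (evalPoly-++ (ifEqualP A B Q) (coefficient M B) v)) (distribˡ _ _ _)) ⟩
    ΣL (λ B → (monoEval B a *F evalPoly (ifEqualP A B Q) v) +F (monoEval B a *F evalPoly (coefficient M B) v)) Bs
      ≡⟨ ΣL-+ _ _ Bs ⟩
    ΣL (λ B → monoEval B a *F evalPoly (ifEqualP A B Q) v) Bs +F ΣL (λ B → monoEval B a *F evalPoly (coefficient M B) v) Bs
      ≡⟨ cong₂ _+F_ (trans (ΣL-cong Bs (λ B → cong (monoEval B a *F_) (evalPoly-ifEqualP A B Q v))) (trans
                          (ΣL-cong Bs (λ B → ifEqual-*ˡ A B (monoEval B a) (evalPoly Q v)))
                          (ΣL-ifEqual m D A |A|≤D (λ B → monoEval B a *F evalPoly Q v)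
                            (λ B A≗B → cong (_*F evalPoly Q v) (monoEval-cong′ A≗B)))))
                    (sym (regroup D M M≤D a v)) ⟩
    (monoEval A a *F evalPoly Q v) +F evalOver M a v ∎)
    where
    open ≡-Reasoning
    Bs = monomialsUpTo m D
    ifEqual-*ˡ : ∀ A B x y → x *F ifEqual A B y ≡ ifEqual A B (x *F y)
    ifEqual-*ˡ A B x y with A ≟ₑ B
    ... | yes _ = refl
    ... | no _ = zeroʳ x
    monoEval-cong′ : ∀ {B} → (∀ i → A i ≡ B i) → monoEval B a ≡ monoEval A a
    monoEval-cong′ A≗B = ΠF-cong (λ i → cong (a i ^F_) (sym (A≗B i)))

  homogeneous-coefficient : ∀ {k n} {D} (M : PolyOver (suc k) n) → Graded D M → ∀ B →
    Homogeneous (B Fin.zero) (coefficient M B)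
  homogeneous-coefficient [] _ B = []
  homogeneous-coefficient ((A , Q) ∷ M) ((hom , _) ∷ gr) B = Allₚ.++⁺ selected (homogeneous-coefficient M gr B)
    where
    selected : Homogeneous (B Fin.zero) (ifEqualP A B Q)
    selected with A ≟ₑ B
    ... | yes A≗B = All.map (λ deg≡A₀ → trans deg≡A₀ (A≗B Fin.zero)) hom
    ... | no _ = []

  equations : ∀ {k n} → PolyOver (suc k) n → List (Exps (suc k)) → List (Poly n)
  equations M [] = []
  equations M (B ∷ Bs) with B Fin.zero
  ... | zero = equations M Bs
  ... | suc _ = coefficient M B ∷ equations M Bs

  equations-origin : ∀ {k n} {D} (M : PolyOver (suc k) n) → Graded D M → ∀ Bs → CommonZero (equations M Bs) (λ _ → 0F)
  equations-origin M gr [] = []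
  equations-origin M gr (B ∷ Bs) with B Fin.zero in B₀≡
  ... | zero = equations-origin M gr Bs
  ... | suc _ = homogeneous-origin (coefficient M B) (subst (0 <_) (sym B₀≡) (s≤s z≤n)) (homogeneous-coefficient M gr B)
              ∷ equations-origin M gr Bs

  degreeSum-equations : ∀ {k n} {D} (M : PolyOver (suc k) n) → Graded D M → ∀ Bs → degreeSum (equations M Bs) ≤ leadingSum Bs
  degreeSum-equations M gr [] = z≤n
  degreeSum-equations M gr (B ∷ Bs) with B Fin.zero in B₀≡
  ... | zero = degreeSum-equations M gr Bs
  ... | suc _ = ℕₚ.+-mono-≤ (homogeneous⇒degree≤ (coefficient M B) (subst (λ s → Homogeneous s (coefficient M B)) B₀≡ (homogeneous-coefficient M gr B)))
                            (degreeSum-equations M gr Bs)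

  -- Terms with B₀ = 0 do not see a₀, the others have vanishing coefficient.
  ΣL-drop-a₀ : ∀ {k n} (M : PolyOver (suc k) n) v Bs → CommonZero (equations M Bs) v → ∀ a →
    ΣL (λ B → monoEval B a *F evalPoly (coefficient M B) v) Bs ≡
    ΣL (λ B → monoEval B (0F ◂ (λ i → a (Fin.suc i))) *F evalPoly (coefficient M B) v) Bs
  ΣL-drop-a₀ M v [] _ a = refl
  ΣL-drop-a₀ M v (B ∷ Bs) zeros a with B Fin.zero in B₀≡
  ... | suc _ = cong₂ _+F_ (trans (y≡0⇒x*y≡0 _ (All.head zeros)) (sym (y≡0⇒x*y≡0 _ (All.head zeros))))
                          (ΣL-drop-a₀ M v Bs (All.tail zeros) a)
  ... | zero = cong₂ _+F_ refl (ΣL-drop-a₀ M v Bs zeros a)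
  evalOver-drop-a₀ : ∀ {k n} {D} (M : PolyOver (suc k) n) → Graded D M → ∀ v →
    CommonZero (equations M (monomialsUpTo (suc k) D)) v → ∀ a →
    evalOver M a v ≡ evalOver M (0F ◂ (λ i → a (Fin.suc i))) v
  evalOver-drop-a₀ {D = D} M gr v zeros a =
    trans (regroup D M |M|≤D a v) (trans (ΣL-drop-a₀ M v (monomialsUpTo _ D) zeros a) (sym (regroup D M |M|≤D _ v)))
    where |M|≤D = All.map proj₂ gr

  -- Growing the subspace

  degreeSum-++ : ∀ {n} (Ps Qs : List (Poly n)) → degreeSum (Ps ++ Qs) ≡ degreeSum Ps + degreeSum Qs
  degreeSum-++ [] Qs = refl
  degreeSum-++ (P ∷ Ps) Qs = trans (cong (polyDeg P +_) (degreeSum-++ Ps Qs)) (sym (ℕₚ.+-assoc (polyDeg P) _ _))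

  degreeSum-concat : ∀ {n m} (Pss : Fin m → List (Poly n)) →
    degreeSum (List.concat (List.tabulate Pss)) ≡ sumFin (λ i → degreeSum (Pss i))
  degreeSum-concat {m = zero} Pss = refl
  degreeSum-concat {m = suc m} Pss =
    trans (degreeSum-++ (Pss Fin.zero) _) (cong (degreeSum (Pss Fin.zero) +_) (degreeSum-concat (λ i → Pss (Fin.suc i))))

  degreeSum-varP : ∀ {n k} (ps : Fin k → Fin n) → degreeSum (List.tabulate (λ j → varP (ps j))) ≤ k
  degreeSum-varP {k = zero} ps = z≤n
  degreeSum-varP {n} {suc k} ps = ℕₚ.+-mono-≤ (ℕₚ.⊔-lub (ℕₚ.≤-reflexive (totalDeg-unitₑ (ps Fin.zero))) z≤n)
                                              (degreeSum-varP (λ j → ps (Fin.suc j)))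

  PivotIndependent : ∀ {n k} → (Fin k → Vecq n) → (Fin k → Fin n) → Set
  PivotIndependent {k = k} vs ps = (a : Fin k → Carrier) → (∀ j → lincomb a vs (ps j) ≡ 0F) → ∀ j → a j ≡ 0F

  pivotIndependent-extend : ∀ {n k} {vs : Fin k → Vecq n} {ps} v p → PivotIndependent vs ps →
    (∀ j → v (ps j) ≡ 0F) → ¬ v p ≡ 0F → PivotIndependent (v ◂ vs) (p ◂ ps)
  pivotIndependent-extend {vs = vs} {ps} v p indep v[ps]≡0 v[p]≢0 a comb≡0 = a≡0
    where
    a′ : Fin _ → Carrier
    a′ j = a (Fin.suc j)
    a′≡0 : ∀ j → a′ j ≡ 0F
    a′≡0 = indep a′ (λ j → trans (sym (trans (cong (_+F lincomb a′ vs (ps j)) (y≡0⇒x*y≡0 _ (v[ps]≡0 j))) (+-identityˡ _)))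
                                  (comb≡0 (Fin.suc j)))
    a₀v[p]≡0 : a Fin.zero *F v p ≡ 0F
    a₀v[p]≡0 = trans (sym (trans (cong ((a Fin.zero *F v p) +F_) (ΣF-zero _ (λ j → x≡0⇒x*y≡0 _ (a′≡0 j)))) (+-identityʳ _)))
                     (comb≡0 Fin.zero)
    a≡0 : ∀ j → a j ≡ 0F
    a≡0 Fin.zero = x*y≡0⇒y≡0 v[p]≢0 (trans (*-comm (v p) (a Fin.zero)) a₀v[p]≡0)
    a≡0 (Fin.suc j) = a′≡0 j

  module Construction {n t} (f : Fin t → Vecq n → Carrier) (ds : Fin t → ℕ)
                      (deg-f : ∀ i → HasDegree (f i) (ds i)) (u₀ : Vecq n) where

    poly : Fin t → Poly n
    poly i = proj₁ (deg-f i)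

    f≡poly : ∀ i x → f i x ≡ evalPoly (poly i) x
    f≡poly i = proj₁ (proj₂ (proj₂ (deg-f i)))

    polyDeg-poly : ∀ i → polyDeg (poly i) ≡ ds i
    polyDeg-poly i = proj₂ (proj₂ (proj₂ (deg-f i)))

    f-cong : ∀ i {x y} → (∀ j → x j ≡ y j) → f i x ≡ f i y
    f-cong i x≗y = trans (f≡poly i _) (trans (evalPoly-cong (poly i) x≗y) (sym (f≡poly i _)))

    record Flat (k : ℕ) : Set where
      field
        vectors : Fin k → Vecq n
        pivots : Fin k → Fin n
        independent : PivotIndependent vectors pivots
        constant : ∀ i a → f i (u₀ +V lincomb a vectors) ≡ f i u₀

    flat₀ : Flat 0
    flat₀ = record
      { vectors = λ ()
      ; pivots = λ ()
      ; independent = λ a _ ()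
      ; constant = λ i a → f-cong i (λ j → +-identityʳ (u₀ j))
      }

    -- A new direction v must vanish at the old pivots and kill every coefficient of
    -- f(u₀ + a₀ v + Σ aⱼ vⱼ) that involves a₀; Chevalley–Warning finds a nonzero one.
    extend : ∀ k → bound ds k < n → Flat k → Flat (suc k)
    extend k bound<n flat = record
      { vectors = v ◂ vectors
      ; pivots = p ◂ pivots
      ; independent = pivotIndependent-extend {vs = vectors} v p independent v[pivots]≡0 v[p]≢0
      ; constant = constant′
      }
      where
      open Flat flat
      open Expansion u₀ vectors
      expansion : Fin t → PolyOver (suc k) n
      expansion i = expand (poly i)
      graded : ∀ i → Graded (ds i) (expansion i)
      graded i = subst (λ D → Graded D (expansion i)) (polyDeg-poly i) (graded-expand (poly i))
      invariance : Fin t → List (Poly n)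
      invariance i = equations (expansion i) (monomialsUpTo (suc k) (ds i))
      pivotEqs : List (Poly n)
      pivotEqs = List.tabulate (λ j → varP (pivots j))
      system : List (Poly n)
      system = pivotEqs ++ List.concat (List.tabulate invariance)

      origin-solves : CommonZero system (λ _ → 0F)
      origin-solves = Allₚ.++⁺ (Allₚ.tabulate⁺ (λ j → evalPoly-varP (pivots j) (λ _ → 0F)))
                               (Allₚ.concat⁺ (Allₚ.tabulate⁺ (λ i → equations-origin (expansion i) (graded i) (monomialsUpTo (suc k) (ds i)))))

      degreeSum< : degreeSum system < n
      degreeSum< = ℕₚ.≤-<-trans (begin
        degreeSum system                                              ≡⟨ degreeSum-++ pivotEqs _ ⟩
        degreeSum pivotEqs + degreeSum (List.concat (List.tabulate invariance)) ≡⟨ cong (degreeSum pivotEqs +_) (degreeSum-concat invariance) ⟩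
        degreeSum pivotEqs + sumFin (λ i → degreeSum (invariance i))  ≤⟨ ℕₚ.+-mono-≤ (degreeSum-varP pivots) (sumFin-mono _ _ per-polynomial) ⟩
        bound ds k                                                    ∎) bound<n
        where
        open ℕₚ.≤-Reasoning
        per-polynomial : ∀ i → degreeSum (invariance i) ≤ suc (ds i) * sumBelow (ds i) (λ j → (ds i ∸ j) * (((k + j) ∸ 1) C j))
        per-polynomial i = ℕₚ.≤-trans (degreeSum-equations (expansion i) (graded i) (monomialsUpTo (suc k) (ds i))) (leadingSum-monomialsUpTo k (ds i))

      solution = chevalley-warning n system origin-solves degreeSum<
      v = proj₁ solution
      p = proj₁ (proj₁ (proj₂ solution))
      v[p]≢0 = proj₂ (proj₁ (proj₂ solution))
      v-solves : CommonZero system v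
      v-solves = proj₂ (proj₂ solution)

      v[pivots]≡0 : ∀ j → v (pivots j) ≡ 0F
      v[pivots]≡0 j = trans (sym (evalPoly-varP (pivots j) v)) (Allₚ.tabulate⁻ (Allₚ.++⁻ˡ pivotEqs v-solves) j)

      v-invariance : ∀ i → CommonZero (invariance i) v
      v-invariance = Allₚ.tabulate⁻ (Allₚ.concat⁻ (Allₚ.++⁻ʳ pivotEqs v-solves))

      constant′ : ∀ i a → f i (u₀ +V lincomb a (v ◂ vectors)) ≡ f i u₀
      constant′ i a = begin
        f i (point a v)                              ≡⟨ f≡poly i _ ⟩
        evalPoly (poly i) (point a v)                ≡⟨ sym (evalOver-expand (poly i) a v) ⟩
        evalOver (expansion i) a v                   ≡⟨ evalOver-drop-a₀ (expansion i) (graded i) v (v-invariance i) a ⟩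
        evalOver (expansion i) (0F ◂ a′) v           ≡⟨ evalOver-expand (poly i) (0F ◂ a′) v ⟩
        evalPoly (poly i) (point (0F ◂ a′) v)        ≡⟨ sym (f≡poly i _) ⟩
        f i (point (0F ◂ a′) v)                      ≡⟨ f-cong i (λ j → cong (u₀ j +F_) (trans (cong (_+F lincomb a′ vectors j) (zeroˡ (v j))) (+-identityˡ _))) ⟩
        f i (u₀ +V lincomb a′ vectors)               ≡⟨ constant i a′ ⟩
        f i u₀                                       ∎
        where
        open ≡-Reasoning
        a′ : Fin k → Carrier
        a′ j = a (Fin.suc j)

    flat : ∀ K → (∀ k → k < K → bound ds k < n) → Flat K
    flat zero _ = flat₀
    flat (suc K) bound<n = extend K (bound<n K ℕₚ.≤-refl) (flat K (λ k k<K → bound<n k (ℕₚ.m<n⇒m<1+n k<K)))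

    constOnAffine : ∀ K → IsLeastK n ds K → ConstOnAffine f u₀ K
    constOnAffine K (_ , least) = vectors , (λ a comb≡0 → independent a (λ j → comb≡0 (pivots j))) , constant
      where open Flat (flat K least)

-- Asymptotics

^-distribʳ-* : ∀ a b e → (a * b) ^ e ≡ a ^ e * b ^ e
^-distribʳ-* a b zero = refl
^-distribʳ-* a b (suc e) = trans (cong (a * b *_) (^-distribʳ-* a b e)) (ℕₚ.[m*n]*[o*p]≡[m*o]*[n*p] a b (a ^ e) (b ^ e))

n<2^n : ∀ n → n < 2 ^ n
n<2^n zero = s≤s z≤n
n<2^n (suc n) = ℕₚ.≤-trans (ℕₚ.+-mono-≤ (ℕₚ.m^n>0 2 n) (n<2^n n)) (ℕₚ.≤-reflexive (cong (2 ^ n +_) (sym (ℕₚ.+-identityʳ _))))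

C≤2^ : ∀ N r → N C r ≤ 2 ^ N
C≤2^ zero zero = ℕₚ.≤-refl
C≤2^ zero (suc r) = z≤n
C≤2^ (suc N) zero = ℕₚ.m^n>0 2 (suc N)
C≤2^ (suc N) (suc r) = begin
  suc N C suc r            ≡⟨ sym (nCk+nC[k+1]≡[n+1]C[k+1] N r) ⟩
  N C r + N C suc r        ≤⟨ ℕₚ.+-mono-≤ (C≤2^ N r) (C≤2^ N (suc r)) ⟩
  2 ^ N + 2 ^ N            ≡⟨ cong (2 ^ N +_) (sym (ℕₚ.+-identityʳ _)) ⟩
  2 ^ suc N                ∎
  where open ℕₚ.≤-Reasoning

C*!≤^ : ∀ N r → r ≤ N → (N C r) * r ! ≤ N ^ r
C*!≤^ N r r≤N = begin
  (N C r) * r !               ≡⟨ cong (_* r !) (nCk≡nPk/k! r≤N) ⟩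
  ((N ℕC.P r) / r !) * r !    ≤⟨ m/n*n≤m (N ℕC.P r) (r !) ⟩
  N ℕC.P r                    ≤⟨ P≤^ ⟩
  N ^ r                       ∎
  where
  open ℕₚ.≤-Reasoning
  instance _ = r ℕₚ.!≢0
  P′≤^ : ∀ r → N ℕC.P′ r ≤ N ^ r
  P′≤^ zero = ℕₚ.≤-refl
  P′≤^ (suc r) = ℕₚ.*-mono-≤ (ℕₚ.m∸n≤m N r) (P′≤^ r)
  P≤^ : N ℕC.P r ≤ N ^ r
  P≤^ with r ℕ.≤ᵇ N
  ... | true = P′≤^ r
  ... | false = z≤n

-- Inductive step: (d + 1)(d - j - 1) ≤ d (d - j).
[1+d]^j*[d∸j]≤d^[1+j] : ∀ d j → j ≤ d → suc d ^ j * (d ∸ j) ≤ d ^ suc j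
[1+d]^j*[d∸j]≤d^[1+j] d zero _ = ℕₚ.≤-reflexive (trans (ℕₚ.+-identityʳ _) (sym (ℕₚ.*-identityʳ d)))
[1+d]^j*[d∸j]≤d^[1+j] d (suc j) j<d = ℕₚ.*-cancelʳ-≤ _ _ (d ∸ j) {{d∸j≢0}} (begin
  suc d ^ suc j * r * (d ∸ j)          ≡⟨ rearrange (suc d) (suc d ^ j) r (d ∸ j) ⟩
  (suc d * r) * (suc d ^ j * (d ∸ j))  ≤⟨ ℕₚ.*-mono-≤ step ([1+d]^j*[d∸j]≤d^[1+j] d j (ℕₚ.<⇒≤ j<d)) ⟩
  (d * suc r) * d ^ suc j              ≡⟨ cong (λ z → (d * z) * d ^ suc j) (sym d∸j≡1+r) ⟩
  (d * (d ∸ j)) * d ^ suc j            ≡⟨ rearrange′ d (d ∸ j) (d ^ suc j) ⟩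
  d ^ suc (suc j) * (d ∸ j)            ∎)
  where
  open ℕₚ.≤-Reasoning
  r = d ∸ suc j
  d∸j≡1+r : d ∸ j ≡ suc r
  d∸j≡1+r = ℕₚ.+-∸-assoc 1 j<d
  d∸j≢0 : NonZero (d ∸ j)
  d∸j≢0 = subst NonZero (sym d∸j≡1+r) _
  step : suc d * r ≤ d * suc r
  step = subst (λ d → suc d * r ≤ d * suc r) (ℕₚ.m+[n∸m]≡n j<d) (ℕₚ.≤-trans (ℕₚ.≤-reflexive (expand₁ j r))
           (ℕₚ.≤-trans (ℕₚ.+-monoʳ-≤ ((suc j + r) * r) (ℕₚ.m≤n+m r (suc j))) (ℕₚ.≤-reflexive (expand₂ j r))))
    where
    expand₁ : ∀ j r → suc (suc j + r) * r ≡ (suc j + r) * r + r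
    expand₁ = solve-∀
    expand₂ : ∀ j r → (suc j + r) * r + (suc j + r) ≡ (suc j + r) * suc r
    expand₂ = solve-∀
  rearrange : ∀ a b c e → a * b * c * e ≡ (a * c) * (b * e)
  rearrange = solve-∀
  rearrange′ : ∀ a b c → (a * b) * c ≡ (a * c) * b
  rearrange′ = solve-∀

[1+d]^j≤2*d^j : ∀ d j → j + j ≤ d → suc d ^ j ≤ 2 * d ^ j
[1+d]^j≤2*d^j zero zero _ = s≤s z≤n
[1+d]^j≤2*d^j d@(suc _) j 2j≤d = ℕₚ.*-cancelʳ-≤ _ _ d (begin
  suc d ^ j * d                 ≤⟨ ℕₚ.*-monoʳ-≤ (suc d ^ j) d≤2[d∸j] ⟩
  suc d ^ j * (2 * (d ∸ j))     ≡⟨ ℕ-*-left-comm (suc d ^ j) 2 (d ∸ j) ⟩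
  2 * (suc d ^ j * (d ∸ j))     ≤⟨ ℕₚ.*-monoʳ-≤ 2 ([1+d]^j*[d∸j]≤d^[1+j] d j (ℕₚ.≤-trans (ℕₚ.m≤m+n j j) 2j≤d)) ⟩
  2 * (d * d ^ j)               ≡⟨ cong (2 *_) (ℕₚ.*-comm d (d ^ j)) ⟩
  2 * (d ^ j * d)               ≡⟨ sym (ℕₚ.*-assoc 2 (d ^ j) d) ⟩
  2 * d ^ j * d                 ∎)
  where
  open ℕₚ.≤-Reasoning
  d≤2[d∸j] : d ≤ 2 * (d ∸ j)
  d≤2[d∸j] = begin
    d                    ≡⟨ sym (ℕₚ.m+[n∸m]≡n (ℕₚ.≤-trans (ℕₚ.m≤m+n j j) 2j≤d)) ⟩
    j + (d ∸ j)          ≤⟨ ℕₚ.+-monoˡ-≤ (d ∸ j) (ℕₚ.m+n≤o⇒m≤o∸n j 2j≤d) ⟩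
    (d ∸ j) + (d ∸ j)    ≡⟨ cong ((d ∸ j) +_) (sym (ℕₚ.+-identityʳ _)) ⟩
    2 * (d ∸ j)          ∎

[1+d]^[j+j]≤4*d^[j+j] : ∀ d j → j + j ≤ d → suc d ^ (j + j) ≤ 4 * d ^ (j + j)
[1+d]^[j+j]≤4*d^[j+j] d j 2j≤d = begin
  suc d ^ (j + j)             ≡⟨ ℕₚ.^-distribˡ-+-* (suc d) j j ⟩
  suc d ^ j * suc d ^ j       ≤⟨ ℕₚ.*-mono-≤ ([1+d]^j≤2*d^j d j 2j≤d) ([1+d]^j≤2*d^j d j 2j≤d) ⟩
  (2 * d ^ j) * (2 * d ^ j)   ≡⟨ ℕₚ.[m*n]*[o*p]≡[m*o]*[n*p] 2 (d ^ j) 2 (d ^ j) ⟩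
  4 * (d ^ j * d ^ j)         ≡⟨ cong (4 *_) (sym (ℕₚ.^-distribˡ-+-* d j j)) ⟩
  4 * d ^ (j + j)             ∎
  where open ℕₚ.≤-Reasoning

parity : ∀ d → ∃ λ j → d ≡ j + j ⊎ d ≡ suc (j + j)
parity zero = 0 , inj₁ refl
parity (suc d) with parity d
... | j , inj₁ d≡2j = j , inj₂ (cong suc d≡2j)
... | j , inj₂ d≡1+2j = suc j , inj₁ (cong suc (trans d≡1+2j (sym (ℕₚ.+-suc j j))))

[1+d]^d≤8*d^d : ∀ d → suc d ^ d ≤ 8 * d ^ d
[1+d]^d≤8*d^d zero = s≤s z≤n
[1+d]^d≤8*d^d d@(suc d′) with parity d
... | j , inj₁ d≡2j = subst (λ m → suc d ^ m ≤ 8 * d ^ m) (sym d≡2j)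
  (ℕₚ.≤-trans ([1+d]^[j+j]≤4*d^[j+j] d j (ℕₚ.≤-reflexive (sym d≡2j))) (ℕₚ.*-monoˡ-≤ (d ^ (j + j)) (ℕₚ.m≤m+n 4 4)))
... | j , inj₂ d≡1+2j = subst (λ m → suc d ^ m ≤ 8 * d ^ m) (sym d≡1+2j) (begin
  suc d * suc d ^ (j + j)       ≤⟨ ℕₚ.*-mono-≤ (s≤s (ℕₚ.m≤n+m d d′)) ([1+d]^[j+j]≤4*d^[j+j] d j 2j≤d) ⟩
  (d + d) * (4 * d ^ (j + j))   ≡⟨ rearrange d (d ^ (j + j)) ⟩
  8 * (d * d ^ (j + j))         ∎)
  where
  open ℕₚ.≤-Reasoning
  2j≤d : j + j ≤ d
  2j≤d = ℕₚ.≤-trans (ℕₚ.n≤1+n _) (ℕₚ.≤-reflexive (sym d≡1+2j))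
  rearrange : ∀ a x → (a + a) * (4 * x) ≡ 8 * (a * x)
  rearrange = solve-∀

e^e≤8^e*e! : ∀ e → e ^ e ≤ 8 ^ e * e !
e^e≤8^e*e! zero = s≤s z≤n
e^e≤8^e*e! (suc e) = begin
  suc e * suc e ^ e             ≤⟨ ℕₚ.*-monoʳ-≤ (suc e) ([1+d]^d≤8*d^d e) ⟩
  suc e * (8 * e ^ e)           ≤⟨ ℕₚ.*-monoʳ-≤ (suc e) (ℕₚ.*-monoʳ-≤ 8 (e^e≤8^e*e! e)) ⟩
  suc e * (8 * (8 ^ e * e !))   ≡⟨ rearrange (suc e) (8 ^ e) (e !) ⟩
  8 * 8 ^ e * (suc e * e !)     ∎
  where
  open ℕₚ.≤-Reasoning
  rearrange : ∀ a b c → a * (8 * (b * c)) ≡ 8 * b * (a * c)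
  rearrange = solve-∀

bound-≤ : ∀ {t} (ds : Fin t → ℕ) {d} k {K} → (∀ i → ds i ≤ d) → (∀ j → j < d → ((k + j) ∸ 1) C j ≤ K) →
  bound ds k ≤ k + t * (suc d * (d * (d * K)))
bound-≤ ds {d} k {K} ds≤d C≤K = ℕₚ.+-monoʳ-≤ k (sumFin-≤ _ term≤)
  where
  term≤ : ∀ i → suc (ds i) * sumBelow (ds i) (λ j → (ds i ∸ j) * (((k + j) ∸ 1) C j)) ≤ suc d * (d * (d * K))
  term≤ i = ℕₚ.*-mono-≤ (s≤s (ds≤d i))
    (ℕₚ.≤-trans (sumBelow-≤ (ds i) _ (λ j j<dᵢ → ℕₚ.*-mono-≤ (ℕₚ.≤-trans (ℕₚ.m∸n≤m (ds i) j) (ds≤d i)) (C≤K j (ℕₚ.<-≤-trans j<dᵢ (ds≤d i)))))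
                (ℕₚ.*-monoˡ-≤ (d * K) (ds≤d i)))

x+x<x*x : ∀ x → 2 < x → x + x < x * x
x+x<x*x x@(suc x′) 2<x = ℕₚ.≤-trans (ℕₚ.≤-reflexive (cong suc (x+x≡x*2 x))) (ℕₚ.*-monoʳ-< x 2<x)
  where x+x≡x*2 : ∀ x → x + x ≡ x * 2
        x+x≡x*2 = solve-∀

-- With a = 2^d: d + (d+1) d² 4^d ≤ 2 a⁵ < a¹⁰ = 1024^d.
small-bound< : ∀ d → 1 ≤ d → d + suc d * (d * (d * (2 ^ d * 2 ^ d))) < 1024 ^ d
small-bound< d 1≤d = begin-strict
  d + suc d * (d * (d * (a * a)))  ≤⟨ ℕₚ.+-mono-≤ (ℕₚ.<⇒≤ (n<2^n d)) (ℕₚ.*-mono-≤ (n<2^n d) (ℕₚ.*-mono-≤ d≤a (ℕₚ.*-monoˡ-≤ (a * a) d≤a))) ⟩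
  a + a⁵                           ≤⟨ ℕₚ.+-monoˡ-≤ a⁵ (ℕₚ.m≤m*n a (a * (a * (a * a))) {{ℕ.>-nonZero 1≤a⁴}}) ⟩
  a⁵ + a⁵                          <⟨ x+x<x*x a⁵ 2<a⁵ ⟩
  a⁵ * a⁵                          ≡⟨ powers a ⟩
  a ^ 10                           ≡⟨ ℕₚ.^-*-assoc 2 d 10 ⟩
  2 ^ (d * 10)                     ≡⟨ cong (2 ^_) (ℕₚ.*-comm d 10) ⟩
  2 ^ (10 * d)                     ≡⟨ sym (ℕₚ.^-*-assoc 2 10 d) ⟩
  1024 ^ d                         ∎
  where
  open ℕₚ.≤-Reasoning
  a = 2 ^ d
  a⁵ = a * (a * (a * (a * a)))
  d≤a = ℕₚ.<⇒≤ (n<2^n d)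
  2≤a : 2 ≤ a
  2≤a = ℕₚ.^-monoʳ-≤ 2 1≤d
  2<a⁵ : 2 < a⁵
  2<a⁵ = ℕₚ.≤-trans (s≤s (s≤s (s≤s z≤n))) (ℕₚ.*-mono-≤ 2≤a (ℕₚ.*-mono-≤ 2≤a (ℕₚ.*-mono-≤ 2≤a (ℕₚ.*-mono-≤ 2≤a 2≤a))))
  1≤a⁴ : 1 ≤ a * (a * (a * a))
  1≤a⁴ = ℕₚ.*-mono-≤ 1≤a (ℕₚ.*-mono-≤ 1≤a (ℕₚ.*-mono-≤ 1≤a 1≤a))
    where 1≤a = ℕₚ.m^n>0 2 d
  powers : ∀ a → (a * (a * (a * (a * a)))) * (a * (a * (a * (a * a)))) ≡ a * (a * (a * (a * (a * (a * (a * (a * (a * (a * 1)))))))))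
  powers = solve-∀

-- For k < d every binomial C(k+j-1, j) with j < d is below 2^(2d).
small-k⇒bound< : ∀ {t} (ds : Fin t → ℕ) d k → 1 ≤ t → 1 ≤ d → (∀ i → ds i ≤ d) → k < d → bound ds k < t * 1024 ^ d
small-k⇒bound< {t} ds d k 1≤t 1≤d ds≤d k<d = begin-strict
  bound ds k        ≤⟨ bound-≤ ds k ds≤d C≤4^d ⟩
  k + t * X         ≤⟨ ℕₚ.+-monoˡ-≤ (t * X) (ℕₚ.≤-trans (ℕₚ.<⇒≤ k<d) (ℕₚ.m≤n*m d t {{ℕ.>-nonZero 1≤t}})) ⟩
  t * d + t * X     ≡⟨ sym (ℕₚ.*-distribˡ-+ t d X) ⟩
  t * (d + X)       <⟨ ℕₚ.*-monoʳ-< t {{ℕ.>-nonZero 1≤t}} (small-bound< d 1≤d) ⟩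
  t * 1024 ^ d      ∎
  where
  open ℕₚ.≤-Reasoning
  X = suc d * (d * (d * (2 ^ d * 2 ^ d)))
  C≤4^d : ∀ j → j < d → ((k + j) ∸ 1) C j ≤ 2 ^ d * 2 ^ d
  C≤4^d j j<d = begin
    ((k + j) ∸ 1) C j  ≤⟨ C≤2^ ((k + j) ∸ 1) j ⟩
    2 ^ ((k + j) ∸ 1)  ≤⟨ ℕₚ.^-monoʳ-≤ 2 (ℕₚ.≤-trans (ℕₚ.m∸n≤m (k + j) 1) (ℕₚ.+-mono-≤ (ℕₚ.<⇒≤ k<d) (ℕₚ.<⇒≤ j<d))) ⟩
    2 ^ (d + d)        ≡⟨ ℕₚ.^-distribˡ-+-* 2 d d ⟩
    2 ^ d * 2 ^ d      ∎

8^e≡[2^e]³ : ∀ e → 8 ^ e ≡ 2 ^ e * (2 ^ e * 2 ^ e)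
8^e≡[2^e]³ e = trans (^-distribʳ-* 2 4 e) (cong (2 ^ e *_) (^-distribʳ-* 2 2 e))

1+8[e+2][e+1]²≤256^e : ∀ e → 1 ≤ e → 1 + 8 * (suc (suc e) * (suc e * suc e)) ≤ 256 ^ e
1+8[e+2][e+1]²≤256^e e 1≤e = begin
  1 + 8 * (suc (suc e) * (suc e * suc e))  ≤⟨ ℕₚ.+-monoʳ-≤ 1 (ℕₚ.*-monoʳ-≤ 8 (ℕₚ.*-mono-≤ (n<2^n (suc e)) (ℕₚ.*-mono-≤ (n<2^n e) (n<2^n e)))) ⟩
  1 + 8 * (2 * 2 ^ e * (2 ^ e * 2 ^ e))    ≡⟨ cong (1 +_) (trans (rearrange (2 ^ e) (2 ^ e * 2 ^ e)) (cong (16 *_) (sym (8^e≡[2^e]³ e)))) ⟩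
  1 + 16 * 8 ^ e                           ≤⟨ ℕₚ.+-monoˡ-≤ (16 * 8 ^ e) (ℕₚ.*-mono-≤ {1} {16} (s≤s z≤n) (ℕₚ.m^n>0 8 e)) ⟩
  16 * 8 ^ e + 16 * 8 ^ e                  ≡⟨ sym (ℕₚ.*-distribʳ-+ (8 ^ e) 16 16) ⟩
  32 * 8 ^ e                               ≤⟨ ℕₚ.*-monoˡ-≤ (8 ^ e) (ℕₚ.^-monoʳ-≤ 32 1≤e) ⟩
  32 ^ e * 8 ^ e                           ≡⟨ sym (^-distribʳ-* 32 8 e) ⟩
  256 ^ e                                  ∎
  where
  open ℕₚ.≤-Reasoning
  rearrange : ∀ x y → 8 * (2 * x * y) ≡ 16 * (x * y)
  rearrange = solve-∀

k*d^e≤[16k]^e : ∀ e k → 1 ≤ e → suc e ≤ k → k * suc e ^ e ≤ (16 * k) ^ e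
k*d^e≤[16k]^e (suc e) k _ d≤k = begin
  k * (suc (suc e) * suc (suc e) ^ e)  ≤⟨ ℕₚ.*-monoʳ-≤ k (ℕₚ.*-mono-≤ (n<2^n (suc e)) (ℕₚ.^-monoˡ-≤ e d≤k)) ⟩
  k * (2 ^ suc e * k ^ e)              ≡⟨ ℕ-*-left-comm k (2 ^ suc e) (k ^ e) ⟩
  2 ^ suc e * k ^ suc e                ≤⟨ ℕₚ.*-monoˡ-≤ (k ^ suc e) (ℕₚ.^-monoˡ-≤ (suc e) (ℕₚ.m≤m+n 2 14)) ⟩
  16 ^ suc e * k ^ suc e               ≡⟨ sym (^-distribʳ-* 16 k (suc e)) ⟩
  (16 * k) ^ suc e                     ∎
  where open ℕₚ.≤-Reasoning

-- C(k-1+e, e) e! ≤ (k-1+e)^e ≤ (2k)^e, and (e+1)^e ≤ 8 e^e ≤ 8 · 8^e e!.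
C*d^e≤8[16k]^e : ∀ e k′ → e ≤ k′ → ((k′ + e) C e) * suc e ^ e ≤ 8 * (16 * suc k′) ^ e
C*d^e≤8[16k]^e e k′ e≤k′ = begin
  K * suc e ^ e                 ≤⟨ ℕₚ.*-monoʳ-≤ K (ℕₚ.≤-trans ([1+d]^d≤8*d^d e) (ℕₚ.*-monoʳ-≤ 8 (e^e≤8^e*e! e))) ⟩
  K * (8 * (8 ^ e * e !))       ≡⟨ rearrange K (8 ^ e) (e !) ⟩
  8 * 8 ^ e * (K * e !)         ≤⟨ ℕₚ.*-monoʳ-≤ (8 * 8 ^ e) (C*!≤^ (k′ + e) e (ℕₚ.m≤n+m e k′)) ⟩
  8 * 8 ^ e * (k′ + e) ^ e      ≤⟨ ℕₚ.*-monoʳ-≤ (8 * 8 ^ e) (ℕₚ.^-monoˡ-≤ e k′+e≤2k) ⟩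
  8 * 8 ^ e * (2 * suc k′) ^ e  ≡⟨ ℕₚ.*-assoc 8 (8 ^ e) _ ⟩
  8 * (8 ^ e * (2 * suc k′) ^ e) ≡⟨ cong (8 *_) (sym (trans (cong (_^ e) (ℕₚ.*-assoc 8 2 (suc k′))) (^-distribʳ-* 8 (2 * suc k′) e))) ⟩
  8 * (16 * suc k′) ^ e         ∎
  where
  open ℕₚ.≤-Reasoning
  K = (k′ + e) C e
  rearrange : ∀ b x y → b * (8 * (x * y)) ≡ 8 * x * (b * y)
  rearrange = solve-∀
  k′+e≤2k : k′ + e ≤ 2 * suc k′
  k′+e≤2k = ℕₚ.≤-trans (ℕₚ.+-mono-≤ (ℕₚ.n≤1+n k′) (ℕₚ.≤-trans e≤k′ (ℕₚ.n≤1+n k′)))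
                       (ℕₚ.≤-reflexive (cong (suc k′ +_) (sym (ℕₚ.+-identityʳ _))))

large-k⇒bound*d^e≤ : ∀ {t} (ds : Fin t → ℕ) e k → 1 ≤ e → 1 ≤ t → (∀ i → ds i ≤ suc e) → suc e ≤ k →
  bound ds k * suc e ^ e ≤ t * (4096 * k) ^ e
large-k⇒bound*d^e≤ {t} ds e k@(suc k′) 1≤e 1≤t ds≤d (s≤s e≤k′) = begin
  bound ds k * d ^ e                                   ≤⟨ ℕₚ.*-monoˡ-≤ (d ^ e) (bound-≤ ds k ds≤d C≤K) ⟩
  (k + t * X) * d ^ e                                  ≡⟨ distribute k t X (d ^ e) ⟩
  k * d ^ e + t * (X * d ^ e)                          ≤⟨ ℕₚ.+-mono-≤ (k*d^e≤[16k]^e e k 1≤e (s≤s e≤k′)) (ℕₚ.*-monoʳ-≤ t X*d^e≤) ⟩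
  y + t * (suc d * (d * (d * (8 * y))))                ≤⟨ ℕₚ.+-monoˡ-≤ _ (ℕₚ.m≤n*m y t {{ℕ.>-nonZero 1≤t}}) ⟩
  t * y + t * (suc d * (d * (d * (8 * y))))            ≡⟨ collect t y (suc d) d ⟩
  t * ((1 + 8 * (suc d * (d * d))) * y)                ≤⟨ ℕₚ.*-monoʳ-≤ t (ℕₚ.*-monoˡ-≤ y (1+8[e+2][e+1]²≤256^e e 1≤e)) ⟩
  t * (256 ^ e * y)                                    ≡⟨ cong (t *_) (sym (^-distribʳ-* 256 (16 * k) e)) ⟩
  t * (256 * (16 * k)) ^ e                             ≡⟨ cong (λ z → t * z ^ e) (ℕₚ.*-assoc 256 16 k) ⟨
  t * (4096 * k) ^ e                                   ∎
  where
  open ℕₚ.≤-Reasoning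
  d = suc e
  K = (k′ + e) C e
  X = suc d * (d * (d * K))
  y = (16 * k) ^ e
  C≤K : ∀ j → j < d → ((k + j) ∸ 1) C j ≤ K
  C≤K j j<d = C-mono k′ (ℕₚ.≤-pred j<d)
  X*d^e≤ : X * d ^ e ≤ suc d * (d * (d * (8 * y)))
  X*d^e≤ = ℕₚ.≤-trans (ℕₚ.≤-reflexive (reassociate (suc d) d K (d ^ e)))
             (ℕₚ.*-monoʳ-≤ (suc d) (ℕₚ.*-monoʳ-≤ d (ℕₚ.*-monoʳ-≤ d (C*d^e≤8[16k]^e e k′ e≤k′))))
    where reassociate : ∀ s d b x → s * (d * (d * b)) * x ≡ s * (d * (d * (b * x)))
          reassociate = solve-∀
  distribute : ∀ a t x y → (a + t * x) * y ≡ a * y + t * (x * y)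
  distribute = solve-∀
  collect : ∀ t z s d → t * z + t * (s * (d * (d * (8 * z)))) ≡ t * ((1 + 8 * (s * (d * d))) * z)
  collect = solve-∀

-- k < d cannot happen: then bound ds k < 1024^d t ≤ n.
k-lower-bound : ∀ d n t → 2 ≤ d → 1 ≤ t → 2 ^ (10 * d) * t ≤ n → (ds : Fin t → ℕ) → (∀ i → ds i ≤ d) →
  (k : ℕ) → IsLeastK n ds k → n * d ^ (d ∸ 1) ≤ t * (4096 * k) ^ (d ∸ 1)
k-lower-bound d@(suc e) n t (s≤s 1≤e) 1≤t 2^[10d]t≤n ds ds≤d k (n≤bound , _) with k ℕₚ.<? d
... | yes k<d = ⊥-elim (ℕₚ.<-irrefl refl (ℕₚ.≤-<-trans n≤bound (ℕₚ.<-≤-trans (small-k⇒bound< ds d k 1≤t (s≤s z≤n) ds≤d k<d) t*1024^d≤n)))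
  where
  t*1024^d≤n : t * 1024 ^ d ≤ n
  t*1024^d≤n = ℕₚ.≤-trans (ℕₚ.≤-reflexive (trans (ℕₚ.*-comm t _) (cong (_* t) (ℕₚ.^-*-assoc 2 10 d)))) 2^[10d]t≤n
... | no k≮d = ℕₚ.≤-trans (ℕₚ.*-monoˡ-≤ (d ^ e) n≤bound) (large-k⇒bound*d^e≤ ds e k 1≤e 1≤t ds≤d (ℕₚ.≮⇒≥ k≮d))

theorem3p5 :
    ((𝔽 : FiniteField) →
       (n t : ℕ) (f : Fin t → FF.Vecq 𝔽 n → FiniteField.Carrier 𝔽) (ds : Fin t → ℕ) →
       ((i : Fin t) → FF.HasDegree 𝔽 (f i) (ds i)) →
       (k : ℕ) → IsLeastK n ds k →
       (u0 : FF.Vecq 𝔽 n) → FF.ConstOnAffine 𝔽 f u0 k)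
    × (Σ ℕ λ m → 1 ≤ m × ((d : ℕ) → 2 ≤ d → Σ ℕ λ N →
         (n t : ℕ) → 1 ≤ t → N * t ≤ n → (ds : Fin t → ℕ) →
         ((i : Fin t) → ds i ≤ d) → (k : ℕ) → IsLeastK n ds k →
         n ≤ t * ((m * k) ^ (d ∸ 1))))
    × (Σ ℕ λ m → 1 ≤ m × ((d n t : ℕ) → 2 ≤ d → 1 ≤ t →
         (2 ^ (10 * d)) * t ≤ n → (ds : Fin t → ℕ) →
         ((i : Fin t) → ds i ≤ d) → (k : ℕ) → IsLeastK n ds k →
         n * (d ^ (d ∸ 1)) ≤ t * ((m * k) ^ (d ∸ 1))))
theorem3p5 =
    (λ 𝔽 n t f ds deg-f k least u₀ → Construction.constOnAffine 𝔽 f ds deg-f u₀ k least)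
  , (4096 , s≤s z≤n , λ d 2≤d → 2 ^ (10 * d) , λ n t 1≤t big ds ds≤d k least →
       ℕₚ.≤-trans (n≤n*d^e n d 2≤d) (k-lower-bound d n t 2≤d 1≤t big ds ds≤d k least))
  , (4096 , s≤s z≤n , k-lower-bound)
  where
  n≤n*d^e : ∀ n d → 2 ≤ d → n ≤ n * d ^ (d ∸ 1)
  n≤n*d^e n d@(suc _) _ = ℕₚ.m≤m*n n (d ^ (d ∸ 1)) {{ℕ.>-nonZero (ℕₚ.m^n>0 d (d ∸ 1))}}
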